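{- Let $T$ be a binary tree of order $n$, let $v\in Core(T)$ and let $w$ be a leaf of $T$ adjacent to $v$. Let $v_1,v_2$ be the other two neighbors of $v$, let $T_v$ be the component of $T-vw$ containing $v$, and for $i=1,2$ let $T_i$ be the component of $T-v$ containing $v_i$. Assume $$ 2\left(1+F_{T_2}(v_2)\right) \geq F_{T_1}(v_1) \geq F_{T_2}(v_2). $$ Then $$ F_{T_v}(v)\ge \begin{cases} 9\cdot2^{\frac{n-4}{2}}-3\cdot2^{\frac{n}{4}}+1, & n\equiv0\pmod 4,\\[4pt] 9\cdot2^{\frac{n-4}{2}}-3\cdot2^{\frac{n-2}{4}}-3\cdot2^{\frac{n-6}{4}}+1, & n\equiv2\pmod 4, \end{cases} $$ with equality if and only if $T_1$ and $T_2$, rooted at $v_1$ and $v_2$, are rooted binary caterpillars with $|V(T_1)|=|V(T_2)|=\frac{n-2}{2}$ if $n\equiv0\pmod 4$, and with $|V(T_1)|=|V(T_2)|+2=\frac{n}{2}$ if $n\equiv2\pmod 4$.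
   Context: A binary tree is a tree in which every non-leaf vertex has degree $3$. $F_S(z)$ denotes the number of subtrees of a tree $S$ containing the vertex $z$. The subtree core $Core(T)$ is the set of vertices maximizing $F_T(\cdot)$. A rooted binary caterpillar rooted at $r$ is a tree which is either the single vertex $r$, or in which $r$ has degree $2$, every other vertex has degree $1$ or $3$, and the vertices of degree at least $2$ induce a path having $r$ as an end vertex. -}

module Defs where

open import Level using (0ℓ)
open import Data.Nat using (ℕ; zero; suc; _+_; _*_; _≤_)
open import Data.Fin using (Fin; toℕ)
open import Data.Fin.Subset using (Subset) renaming (_∈_ to _∈ₛ_)
open import Data.List using (List; []; _∷_; length; lookup; _++_; [_])
open import Data.List.Membership.Propositional using (_∈_)
open import Data.List.Relation.Unary.Unique.Propositional using (Unique)
open import Data.List.Relation.Unary.Linked using (Linked)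
open import Data.Product using (Σ; _×_; _,_)
open import Data.Sum using (_⊎_)
open import Data.Unit using (⊤)
open import Relation.Binary.PropositionalEquality using (_≡_; _≢_)
open import Relation.Nullary using (¬_)
open import Function.Bundles using (_⇔_)

Card : {A : Set} → (A → Set) → ℕ → Set
Card {A} P k = Σ (List A) λ L →
  Unique L × ((x : A) → (x ∈ L) ⇔ P x) × (length L ≡ k)

-- Graphs on the vertex type Fin n: a vertex set V ⊆ Fin n and an
-- adjacency relation E (only edges between vertices of V are relevant).

record Graph (n : ℕ) : Set₁ where
  field
    V : Fin n → Set
    E : Fin n → Fin n → Set
open Graph public

full : {n : ℕ} → (Fin n → Fin n → Set) → Graph n
full E = record { V = λ _ → ⊤ ; E = E }

-- Walks in G all of whose vertices lie in P.
data Path {n : ℕ} (G : Graph n) (P : Fin n → Set) : Fin n → Fin n → Set where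
  here : ∀ {x} → P x → Path G P x x
  step : ∀ {x y z} → P x → E G x y → Path G P y z → Path G P x z

Connected : {n : ℕ} → Graph n → Set
Connected G = ∀ x y → V G x → V G y → Path G (V G) x y

Cycle : {n : ℕ} → Graph n → Set
Cycle {n} G = Σ (Fin n) λ x → Σ (List (Fin n)) λ ys →
  ((y : Fin n) → y ∈ (x ∷ ys) → V G y) ×
  Unique (x ∷ ys) × (2 ≤ length ys) × Linked (E G) ((x ∷ ys) ++ [ x ])

Simple : {n : ℕ} → Graph n → Set
Simple G = (∀ x y → V G x → V G y → E G x y → E G y x) × (∀ x → V G x → ¬ E G x x)

IsTree : {n : ℕ} → Graph n → Set
IsTree {n} G = Simple G × Connected G × ¬ Cycle G × Σ (Fin n) (V G)

Deg : {n : ℕ} → Graph n → Fin n → ℕ → Set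
Deg G x d = Card (λ y → V G y × E G x y) d

IsBinaryTree : {n : ℕ} → Graph n → Set
IsBinaryTree G = IsTree G × (∀ x d → V G x → Deg G x d → d ≢ 1 → d ≡ 3)

Order : {n : ℕ} → Graph n → ℕ → Set
Order G k = Card (V G) k

-- S ⊆ V(G) induces a connected (hence, G being a tree, a sub-tree)
-- subgraph of G, and is nonempty.
IsSubtree : {n : ℕ} → Graph n → Subset n → Set
IsSubtree {n} G S =
  (∀ x → x ∈ₛ S → V G x) ×
  (∀ x y → x ∈ₛ S → y ∈ₛ S → Path G (_∈ₛ S) x y) ×
  Σ (Fin n) (_∈ₛ S)

SubtreeCount : {n : ℕ} → Graph n → Fin n → ℕ → Set
SubtreeCount G z k = Card (λ S → z ∈ₛ S × IsSubtree G S) k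

InCore : {n : ℕ} → Graph n → Fin n → Set
InCore G v = V G v × (∀ u a b → V G u → SubtreeCount G v a → SubtreeCount G u b → b ≤ a)

deleteEdge : {n : ℕ} → Graph n → Fin n → Fin n → Graph n
deleteEdge G a b = record
  { V = V G
  ; E = λ x y → E G x y × ¬ ((x ≡ a × y ≡ b) ⊎ (x ≡ b × y ≡ a)) }

deleteVertex : {n : ℕ} → Graph n → Fin n → Graph n
deleteVertex G v = record { V = λ x → V G x × x ≢ v ; E = E G }

component : {n : ℕ} → Graph n → Fin n → Graph n
component G z = record { V = λ x → Path G (V G) z x ; E = E G }

-- The vertices of degree ≥ 2 induce a path having r as an end vertex:
-- they are exactly the entries of a duplicate-free list r ∷ ps whose
-- consecutive entries are adjacent and with no other adjacencies.
DegAtLeast2InducePathFrom : {n : ℕ} → Graph n → Fin n → Set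
DegAtLeast2InducePathFrom {n} G r = Σ (List (Fin n)) λ ps →
  let P = r ∷ ps in
  Unique P ×
  ((x : Fin n) → (x ∈ P) ⇔ (V G x × Σ ℕ λ d → Deg G x d × 2 ≤ d)) ×
  Linked (E G) P ×
  ((i j : Fin (length P)) → E G (lookup P i) (lookup P j) →
     (toℕ j ≡ suc (toℕ i)) ⊎ (toℕ i ≡ suc (toℕ j)))

IsRootedBinaryCaterpillar : {n : ℕ} → Graph n → Fin n → Set
IsRootedBinaryCaterpillar G r =
  IsTree G × V G r ×
  ( (∀ x → V G x → x ≡ r)
  ⊎ ( Deg G r 2 ×
      (∀ x → V G x → x ≢ r → Deg G x 1 ⊎ Deg G x 3) ×
      DegAtLeast2InducePathFrom G r ) )

module Submission where

-- For an edge pr of a binary tree, let the branch at r (the component of T − p containing r) have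
-- 1 + 2α vertices and let F count its subtrees containing r. Splitting at the two children a, b of r
-- gives F = (1 + F_a)(1 + F_b), and by induction F + 2 = 3·2^α + e with an excess e ≥ 0 which
-- vanishes exactly when the branch is a rooted caterpillar: the excess of a fork is
-- 3(2^α_a − 1)(2^α_b − 1) plus terms that are multiples of e_a or e_b, so it vanishes iff both
-- children are caterpillars and one of them is a single vertex.
--
-- As w is a leaf, F_{T_v}(v) = (1 + F_{T_1}(v_1))(1 + F_{T_2}(v_2)) and n = 2 + |T_1| + |T_2| fixes
-- α_1 + α_2. If α_1, α_2 are not as equal as the parity of n allows, the balance condition
-- F_2 ≤ F_1 ≤ 2(1 + F_2) makes both factors so large that the bound is strict; otherwise the
-- product is the product of the caterpillar values plus a non-negative term in e_1, e_2.

open import Data.Bool using (Bool; true; false)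
import Data.Bool as Bool
open import Data.Empty using (⊥; ⊥-elim)
open import Data.Fin using (Fin; toℕ) renaming (zero to fzero; suc to fsuc; _≟_ to _≟ᶠ_)
open import Data.Fin.Properties using (toℕ-injective)
open import Data.Fin.Subset using (Subset; ⁅_⁆; _∪_; _∩_) renaming (_∈_ to _∈ₛ_; _∉_ to _∉ₛ_; ⊥ to ∅)
open import Data.Fin.Subset.Properties
  using (⊆-antisym; ∉⊥; x∈⁅x⁆; x∈⁅y⁆⇒x≡y; x∈p∪q⁺; x∈p∪q⁻; x∈p∩q⁺; x∈p∩q⁻) renaming (_∈?_ to _∈ₛ?_)
open import Data.List using (List; []; _∷_; length; filter; _++_; drop; map; cartesianProduct; allFin; lookup)
open import Data.List.Properties using (length-tabulate; filter-notAll; length-++; length-map; map-∘; map-id-local)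
open import Data.List.Membership.Propositional using (_∈_; find; lose)
open import Data.List.Membership.Propositional.Properties
  using (∈-allFin; ∈-lookup; ∈-filter⁺; ∈-filter⁻; ∈-++⁺ˡ; ∈-++⁺ʳ; ∈-++⁻; ∈-cartesianProduct⁺;
         ∈-cartesianProduct⁻; ∈-map⁺; ∈-map⁻)
import Data.List.Membership.DecPropositional as DecMembership
open import Data.List.Relation.Unary.All as All using (All; []; _∷_)
open import Data.List.Relation.Unary.All.Properties using (¬Any⇒All¬)
open import Data.List.Relation.Unary.Any using (Any; here; there; any?; index)
open import Data.List.Relation.Unary.Any.Properties using (lookup-index)
open import Data.List.Relation.Unary.Linked using (Linked; [-]; _∷_)
open import Data.List.Relation.Unary.Unique.Propositional using (Unique; []; _∷_)
open import Data.List.Relation.Unary.Unique.Propositional.Properties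
  using (allFin⁺; filter⁺; ++⁺; cartesianProduct⁺; map⁺; map⁻; drop⁺)
open import Data.Nat using (ℕ; zero; suc; _+_; _*_; _^_; _∸_; _≤_; _<_; _≥_; z≤n; s≤s; s≤s⁻¹; NonZero)
open import Data.Nat.Induction using (<-rec)
open import Data.Nat.Properties
  using (≤-reflexive; ≤-trans; ≤-antisym; <⇒≤; <⇒≢; <-≤-trans; <-irrefl; <-cmp; _<?_; ≮⇒≥;
         m≤m+n; m<m+n; m≤m*n; m≤n*m; m≤n⇒∃[o]m+o≡n; suc-injective; +-suc; +-comm; *-comm; +-identityʳ;
         +-cancelˡ-≡; +-cancelʳ-≡; *-cancelˡ-≡; +-cancelˡ-≤; *-cancelˡ-≤;
         +-mono-≤; +-mono-<; +-monoˡ-≤; +-monoʳ-≤; *-monoˡ-≤; *-monoʳ-≤; ^-monoʳ-≤; ^-distribˡ-+-*;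
         m+n≡0⇒m≡0; m+n≡0⇒n≡0; m*n≡0⇒m≡0; m*n≡0⇒m≡0∨n≡0; module ≤-Reasoning)
open import Data.Nat.Tactic.RingSolver using (solve-∀)
open import Data.Product using (Σ; _×_; _,_; proj₁; proj₂; map₂)
open import Data.Product.Function.NonDependent.Propositional using (_×-⇔_)
open import Data.Sum using (_⊎_; inj₁; inj₂; [_,_]; [_,_]′)
import Data.Sum as Sum
open import Data.Sum.Function.Propositional using (_⊎-⇔_)
open import Data.Unit using (⊤; tt)
open import Data.Vec using (Vec; tabulate) renaming ([] to []ᵛ; _∷_ to _∷ᵛ_)
open import Data.Vec.Properties using (lookup∘tabulate; []=⇒lookup; lookup⇒[]=; ≡-dec)
open import Function using (_∘_)
open import Function.Bundles using (_⇔_; mk⇔; Equivalence)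
open import Function.Properties.Equivalence using () renaming (refl to ⇔-refl; sym to ⇔-sym; trans to ⇔-trans)
open import Relation.Binary.Definitions using (DecidableEquality; tri<; tri≈; tri>)
open import Relation.Binary.PropositionalEquality using (_≡_; _≢_; refl; sym; trans; cong; cong₂; subst)
open import Relation.Nullary using (¬_; ¬?; yes; no; does)
open import Relation.Nullary.Decidable using (dec-true; toSum; _×-dec_; map′)
open import Relation.Unary using (Decidable)
open import Defs

open Equivalence using (to; from)

-- Counting

module _ {A : Set} (_≟_ : DecidableEquality A) where

  length-≤-⊆ : ∀ {xs ys : List A} → Unique xs → (∀ {z} → z ∈ xs → z ∈ ys) → length xs ≤ length ys
  length-≤-⊆ {[]} _ _ = z≤n
  length-≤-⊆ {x ∷ xs} {ys} (x∉xs ∷ u) xs⊆ys =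
    ≤-trans (s≤s (length-≤-⊆ u xs⊆ys-x)) (filter-notAll (≢x? ) ys (x∈ys (xs⊆ys (here refl))))
    where
    ≢x? : Decidable (λ z → ¬ z ≡ x)
    ≢x? z = ¬? (z ≟ x)
    xs⊆ys-x : ∀ {z} → z ∈ xs → z ∈ filter ≢x? ys
    xs⊆ys-x z∈xs = ∈-filter⁺ ≢x? (xs⊆ys (there z∈xs)) (λ { refl → All.lookup x∉xs z∈xs refl })
    x∈ys : ∀ {zs} → x ∈ zs → Any (λ z → ¬ ¬ z ≡ x) zs
    x∈ys (here eq) = here (λ z≢x → z≢x (sym eq))
    x∈ys (there m) = there (x∈ys m)

  card-unique : ∀ {P : A → Set} {k l} → Card P k → Card P l → k ≡ l
  card-unique (xs , u , f , refl) (ys , v , g , refl) =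
    ≤-antisym (length-≤-⊆ u (λ m → from (g _) (to (f _) m)))
              (length-≤-⊆ v (λ m → from (f _) (to (g _) m)))

  card-⇔-≡ : ∀ {P : A → Set} {k l} → Card P k → Card P l ⇔ (k ≡ l)
  card-⇔-≡ K = mk⇔ (card-unique K) (λ { refl → K })

card-resp : ∀ {A : Set} {P Q : A → Set} {k} → (∀ x → P x → Q x) → (∀ x → Q x → P x) → Card P k → Card Q k
card-resp P⇒Q Q⇒P (xs , u , f , e) =
  xs , u , (λ x → mk⇔ (λ m → P⇒Q x (to (f x) m)) (λ q → from (f x) (Q⇒P x q))) , e

card-single : ∀ {A : Set} {P : A → Set} {x y} → Card P 1 → P x → P y → x ≡ y
card-single (z ∷ [] , _ , f , refl) px py with from (f _) px | from (f _) py
... | here refl | here refl = refl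

card-filter : ∀ {A : Set} {P : A → Set} (xs : List A) → Unique xs → (∀ x → P x → x ∈ xs) →
  Decidable P → Σ ℕ (Card P)
card-filter xs u P⊆xs P? = length (filter P? xs) , filter P? xs , filter⁺ P? u ,
  (λ x → mk⇔ (λ m → proj₂ (∈-filter⁻ P? {xs = xs} m)) (λ p → ∈-filter⁺ P? (P⊆xs x p) p)) , refl

card-∩ : ∀ {A : Set} {P Q : A → Set} {k} → Card P k → Decidable Q → Σ ℕ (Card (λ x → P x × Q x))
card-∩ (xs , u , f , _) Q? =
  length (filter Q? xs) , filter Q? xs , filter⁺ Q? u ,
  (λ x → mk⇔ (λ m → let (m₁ , q) = ∈-filter⁻ Q? {xs = xs} m in to (f x) m₁ , q)
             (λ (p , q) → ∈-filter⁺ Q? (from (f x) p) q)) , refl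

card-≡ : ∀ {A : Set} (a : A) → Card (_≡ a) 1
card-≡ a = a ∷ [] , [] ∷ [] , (λ x → mk⇔ (λ { (here e) → e ; (there ()) }) here) , refl

card-⊎ : ∀ {A : Set} {P Q : A → Set} {k l} → Card P k → Card Q l → (∀ x → P x → Q x → ⊥) →
  Card (λ x → P x ⊎ Q x) (k + l)
card-⊎ (xs , u , f , refl) (ys , v , g , refl) disjoint =
  xs ++ ys , ++⁺ u v (λ (m₁ , m₂) → disjoint _ (to (f _) m₁) (to (g _) m₂)) ,
  (λ x → mk⇔ (λ m → Sum.map (to (f x)) (to (g x)) (∈-++⁻ xs m))
             (λ { (inj₁ p) → ∈-++⁺ˡ (from (f x) p) ; (inj₂ q) → ∈-++⁺ʳ xs (from (g x) q) })) ,
  length-++ xs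

length-cartesianProduct : ∀ {A B : Set} (xs : List A) (ys : List B) →
  length (cartesianProduct xs ys) ≡ length xs * length ys
length-cartesianProduct [] ys = refl
length-cartesianProduct (x ∷ xs) ys =
  trans (length-++ (map (x ,_) ys)) (cong₂ _+_ (length-map (x ,_) ys) (length-cartesianProduct xs ys))

card-× : ∀ {A B : Set} {P : A → Set} {Q : B → Set} {k l} → Card P k → Card Q l →
  Card (λ (xy : A × B) → P (proj₁ xy) × Q (proj₂ xy)) (k * l)
card-× (xs , u , f , refl) (ys , v , g , refl) =
  cartesianProduct xs ys , cartesianProduct⁺ u v ,
  (λ (x , y) → mk⇔ (λ m → let (m₁ , m₂) = ∈-cartesianProduct⁻ xs ys m in to (f x) m₁ , to (g y) m₂)
                   (λ (p , q) → ∈-cartesianProduct⁺ (from (f x) p) (from (g y) q))) ,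
  length-cartesianProduct xs ys

card-image : ∀ {A B : Set} {P : A → Set} {Q : B → Set} {k} → Card Q k → (g : B → A) (ρ : A → B) →
  (∀ b → Q b → ρ (g b) ≡ b) → (∀ b → Q b → P (g b)) → (∀ a → P a → Σ B (λ b → Q b × a ≡ g b)) → Card P k
card-image {P = P} (xs , u , f , refl) g ρ ρ∘g≡id Q⇒P P⇒Q =
  map g xs , map⁻ {f = ρ} (subst Unique (sym ρ∘g∘xs≡xs) u) ,
  (λ a → mk⇔ (λ m → let (b , b∈ , e) = ∈-map⁻ g m in subst P (sym e) (Q⇒P b (to (f b) b∈)))
             (λ pa → let (b , qb , e) = P⇒Q a pa in subst (_∈ map g xs) (sym e) (∈-map⁺ g (from (f b) qb)))) ,
  length-map g xs
  where
  ρ∘g∘xs≡xs : map ρ (map g xs) ≡ xs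
  ρ∘g∘xs≡xs = trans (sym (map-∘ xs)) (map-id-local (All.tabulate (λ m → ρ∘g≡id _ (to (f _) m))))

allVecs : (n : ℕ) → List (Vec Bool n)
allVecs zero = []ᵛ ∷ []
allVecs (suc n) = map (true ∷ᵛ_) (allVecs n) ++ map (false ∷ᵛ_) (allVecs n)

allVecs-unique : ∀ n → Unique (allVecs n)
allVecs-unique zero = [] ∷ []
allVecs-unique (suc n) = ++⁺ (map⁺ ∷-injective (allVecs-unique n)) (map⁺ ∷-injective (allVecs-unique n)) disjoint
  where
  ∷-injective : ∀ {b : Bool} {x y : Vec Bool n} → (b ∷ᵛ x) ≡ (b ∷ᵛ y) → x ≡ y
  ∷-injective refl = refl
  disjoint : ∀ {v} → v ∈ map (true ∷ᵛ_) (allVecs n) × v ∈ map (false ∷ᵛ_) (allVecs n) → ⊥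
  disjoint (m₁ , m₂) with ∈-map⁻ (true ∷ᵛ_) m₁ | ∈-map⁻ (false ∷ᵛ_) m₂
  ... | _ , _ , refl | _ , _ , ()

∈-allVecs : ∀ {n} (v : Vec Bool n) → v ∈ allVecs n
∈-allVecs []ᵛ = here refl
∈-allVecs (true ∷ᵛ v) = ∈-++⁺ˡ (∈-map⁺ (true ∷ᵛ_) (∈-allVecs v))
∈-allVecs {suc n} (false ∷ᵛ v) = ∈-++⁺ʳ (map (true ∷ᵛ_) (allVecs n)) (∈-map⁺ (false ∷ᵛ_) (∈-allVecs v))

card-Vec : ∀ {n} {Q : Vec Bool n → Set} → Decidable Q → Σ ℕ (Card Q)
card-Vec {n} = card-filter (allVecs n) (allVecs-unique n) (λ v _ → ∈-allVecs v)

card-Fin : ∀ {n} {Q : Fin n → Set} → Decidable Q → Σ ℕ (Card Q)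
card-Fin {n} = card-filter (allFin n) (allFin⁺ n) (λ x _ → ∈-allFin x)

module _ {n : ℕ} where

  setOf : {P : Fin n → Set} → Decidable P → Subset n
  setOf P? = tabulate (λ x → does (P? x))

  ∈-setOf⁺ : {P : Fin n → Set} (P? : Decidable P) {x : Fin n} → P x → x ∈ₛ setOf P?
  ∈-setOf⁺ P? {x} p = lookup⇒[]= x (setOf P?) (trans (lookup∘tabulate _ x) (dec-true (P? x) p))

  ∈-setOf⁻ : {P : Fin n → Set} (P? : Decidable P) {x : Fin n} → x ∈ₛ setOf P? → P x
  ∈-setOf⁻ P? {x} m with P? x | trans (sym (lookup∘tabulate (λ x → does (P? x)) x)) ([]=⇒lookup m)
  ... | yes p | _ = p
  ... | no _ | ()

  ∈-∩setOf⁺ : ∀ {S} {P : Fin n → Set} (P? : Decidable P) {x} → x ∈ₛ S → P x → x ∈ₛ S ∩ setOf P?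
  ∈-∩setOf⁺ P? x∈ px = x∈p∩q⁺ (x∈ , ∈-setOf⁺ P? px)

  ∈-∩setOf⁻ : ∀ {S} {P : Fin n → Set} (P? : Decidable P) {x} → x ∈ₛ S ∩ setOf P? → x ∈ₛ S × P x
  ∈-∩setOf⁻ {S} P? x∈ = map₂ (∈-setOf⁻ P?) (x∈p∩q⁻ S (setOf P?) x∈)

  ∈-⁅⁆∪⁻ : ∀ {r : Fin n} {A x} → x ∈ₛ ⁅ r ⁆ ∪ A → x ≡ r ⊎ x ∈ₛ A
  ∈-⁅⁆∪⁻ {r} {A} x∈ = Sum.map₁ (x∈⁅y⁆⇒x≡y r) (x∈p∪q⁻ ⁅ r ⁆ A x∈)

  ∈-⁅⁆∪⁺ : ∀ {r : Fin n} {A x} → x ≡ r ⊎ x ∈ₛ A → x ∈ₛ ⁅ r ⁆ ∪ A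
  ∈-⁅⁆∪⁺ = x∈p∪q⁺ ∘ Sum.map₁ (λ { refl → x∈⁅x⁆ _ })

  r∈⁅r⁆∪ : ∀ {r : Fin n} {A} → r ∈ₛ ⁅ r ⁆ ∪ A
  r∈⁅r⁆∪ = ∈-⁅⁆∪⁺ (inj₁ refl)

  _≟ˢ_ : DecidableEquality (Subset n)
  _≟ˢ_ = ≡-dec Bool._≟_

  ⊆-antisym′ : {S T : Subset n} → (∀ x → x ∈ₛ S → x ∈ₛ T) → (∀ x → x ∈ₛ T → x ∈ₛ S) → S ≡ T
  ⊆-antisym′ S⊆T T⊆S = ⊆-antisym (λ {x} → S⊆T x) (λ {x} → T⊆S x)

-- Walks

module _ {n : ℕ} {G : Graph n} {P : Fin n → Set} where

  Path-start : ∀ {x y} → Path G P x y → P x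
  Path-start (here p) = p
  Path-start (step p _ _) = p

  Path-end : ∀ {x y} → Path G P x y → P y
  Path-end (here p) = p
  Path-end (step _ _ w) = Path-end w

  Path-map : ∀ {H : Graph n} {Q : Fin n → Set} → (∀ {a b} → P a → P b → E G a b → E H a b) → (∀ z → P z → Q z) →
    ∀ {x y} → Path G P x y → Path H Q x y
  Path-map f g (here p) = here (g _ p)
  Path-map f g (step p e w) = step (g _ p) (f p (Path-start w) e) (Path-map f g w)

  Path-cast : ∀ {H : Graph n} → (∀ {a b} → E G a b → E H a b) → ∀ {x y} → Path G P x y → Path H P x y
  Path-cast f = Path-map (λ _ _ → f) (λ _ p → p)

module Walks {n : ℕ} (E : Fin n → Fin n → Set) (E-sym : ∀ {x y} → E x y → E y x) where

  open DecMembership (_≟ᶠ_ {n}) using (_∈?_)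

  Walk : (Fin n → Set) → Fin n → Fin n → Set
  Walk = Path (full E)

  _++ʷ_ : ∀ {P x y z} → Walk P x y → Walk P y z → Walk P x z
  here _ ++ʷ w′ = w′
  step p e w ++ʷ w′ = step p e (w ++ʷ w′)

  _∷ʳʷ_ : ∀ {P x y z} → Walk P x y → E y z × P z → Walk P x z
  w ∷ʳʷ (e , pz) = w ++ʷ step (Path-end w) e (here pz)

  reverseʷ : ∀ {P x y} → Walk P x y → Walk P y x
  reverseʷ (here p) = here p
  reverseʷ (step p e w) = reverseʷ w ∷ʳʷ (E-sym e , p)

  mapʷ : ∀ {P Q : Fin n → Set} → (∀ z → P z → Q z) → ∀ {x y} → Walk P x y → Walk Q x y
  mapʷ = Path-map (λ _ _ e → e)

  annotate-prefix : ∀ {P Q : Fin n → Set} {b x y} → (∀ {u v} → Walk Q b u → E u v → P v → Q v) →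
    Walk Q b x → Walk P x y → Walk (λ z → P z × Walk Q b z) x y
  annotate-prefix extend wb (here p) = here (p , wb)
  annotate-prefix extend wb (step p e w) =
    step (p , wb) e (annotate-prefix extend (wb ∷ʳʷ (e , extend wb e (Path-start w))) w)

  last-exit-or-avoid : ∀ {P x y} (r : Fin n) → y ≢ r → Walk P x y →
    Walk (λ z → P z × z ≢ r) x y ⊎ Σ (Fin n) (λ z → E r z × Walk (λ z → P z × z ≢ r) z y)
  last-exit-or-avoid r y≢r (here p) = inj₁ (here (p , y≢r))
  last-exit-or-avoid {x = x} r y≢r (step {y = z} p e w) with last-exit-or-avoid r y≢r w
  ... | inj₂ exit = inj₂ exit
  ... | inj₁ w′ with x ≟ᶠ r
  ...   | yes refl = inj₂ (z , e , w′)
  ...   | no x≢r = inj₁ (step (p , x≢r) e w′)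

  last-exit : ∀ {P y} (r : Fin n) → y ≢ r → Walk P r y →
    Σ (Fin n) (λ z → E r z × Walk (λ z → P z × z ≢ r) z y)
  last-exit r y≢r w with last-exit-or-avoid r y≢r w
  ... | inj₁ w′ = ⊥-elim (proj₂ (Path-start w′) refl)
  ... | inj₂ exit = exit

  first-entry : ∀ {P x} (r : Fin n) → x ≢ r → Walk P x r →
    Σ (Fin n) (λ z → E z r × Walk (λ z → P z × z ≢ r) x z)
  first-entry r x≢r w with last-exit r x≢r (reverseʷ w)
  ... | z , e , w′ = z , E-sym e , reverseʷ w′

  module AvoidPendant {P : Fin n → Set} (r a : Fin n) (a≢r : a ≢ r) (only-a : ∀ z → P z → E r z → z ≡ a) where
    avoid : ∀ {x y} → x ≢ r → y ≢ r → Walk P x y → Walk (λ z → P z × z ≢ r) x y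
    avoid-from : ∀ {y} → y ≢ r → Walk P r y → Walk (λ z → P z × z ≢ r) a y
    avoid x≢r y≢r (here p) = here (p , x≢r)
    avoid {x} x≢r y≢r (step {y = z} p e w) with z ≟ᶠ r
    ... | yes refl = subst (λ t → Walk _ t _) (sym (only-a x p (E-sym e))) (avoid-from y≢r w)
    ... | no z≢r = step (p , x≢r) e (avoid z≢r y≢r w)
    avoid-from y≢r (here p) = ⊥-elim (y≢r refl)
    avoid-from y≢r (step {y = z} p e w) with only-a z (Path-start w) e
    ... | refl = avoid a≢r y≢r w

  vertices : ∀ {P x y} → Walk P x y → List (Fin n)
  vertices {x = x} (here _) = x ∷ []
  vertices {x = x} (step _ _ w) = x ∷ vertices w

  vertices-ok : ∀ {P x y} (w : Walk P x y) → All P (vertices w)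
  vertices-ok (here p) = p ∷ []
  vertices-ok (step p _ w) = p ∷ vertices-ok w

  start∈vertices : ∀ {P x y} (w : Walk P x y) → x ∈ vertices w
  start∈vertices (here _) = here refl
  start∈vertices (step _ _ _) = here refl

  end∈vertices : ∀ {P x y} (w : Walk P x y) → y ∈ vertices w
  end∈vertices (here _) = here refl
  end∈vertices (step _ _ w) = there (end∈vertices w)

  prefix-to : ∀ {P x y u} (w : Walk P x y) → u ∈ vertices w → Walk (_∈ vertices w) x u
  prefix-to (here p) (here refl) = here (here refl)
  prefix-to (step p e w) (here refl) = here (here refl)
  prefix-to (step p e w) (there m) = step (here refl) e (mapʷ (λ _ → there) (prefix-to w m))

  suffix-from : ∀ {P x y u} (w : Walk P x y) → u ∈ vertices w →
    Σ (Walk P u y) λ s → Σ ℕ λ k → vertices s ≡ drop k (vertices w)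
  suffix-from (here p) (here refl) = here p , 0 , refl
  suffix-from (step p e w) (here refl) = step p e w , 0 , refl
  suffix-from (step p e w) (there m) with suffix-from w m
  ... | s , k , eq = s , suc k , eq

  loop-erase : ∀ {P x y} (w : Walk P x y) → Σ (Walk P x y) (λ s → Unique (vertices s))
  loop-erase (here p) = here p , [] ∷ []
  loop-erase {x = x} (step p e w) with loop-erase w
  ... | s , us with x ∈? vertices s
  ...   | no x∉s = step p e s , ¬Any⇒All¬ _ x∉s ∷ us
  ...   | yes x∈s with suffix-from s x∈s
  ...     | s′ , k , eq = s′ , subst Unique (sym eq) (drop⁺ k us)

  closed-linked : ∀ {P x y r t} → E r x → (w : Walk P x y) → E y t → Linked E (r ∷ (vertices w ++ t ∷ []))
  closed-linked e (here p) e′ = e ∷ (e′ ∷ [-])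
  closed-linked e (step p e₁ w) e′ = e ∷ closed-linked e₁ w e′

  -- Loop-erasing such a detour and closing it through r gives a cycle.
  no-detour : ¬ Cycle (full E) → ∀ {r a c} → E r a → E r c → a ≢ c → ¬ Walk (_≢ r) a c
  no-detour acyclic {r} era erc a≢c w with loop-erase w
  ... | here _ , _ = a≢c refl
  ... | s@(step _ _ s′) , us =
    acyclic (r , vertices s , (λ _ _ → tt) , (All.map (λ z≢r r≡z → z≢r (sym r≡z)) (vertices-ok s) ∷ us) ,
             s≤s (nonempty s′) , closed-linked era s (E-sym erc))
    where
    nonempty : ∀ {P x y} (w : Walk P x y) → 1 ≤ length (vertices w)
    nonempty (here _) = s≤s z≤n
    nonempty (step _ _ _) = s≤s z≤n

2^-pred : ∀ α → Σ ℕ λ A′ → 2 ^ α ≡ 1 + A′ × (A′ ≡ 0 ⇔ α ≡ 0)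
2^-pred zero = 0 , refl , mk⇔ (λ _ → refl) (λ _ → refl)
2^-pred (suc α) with 2^-pred α
... | A′ , 2^α≡ , _ = 1 + 2 * A′ , trans (cong (2 *_) 2^α≡) (double-suc A′) , mk⇔ (λ ()) (λ ())
  where
  double-suc : ∀ A′ → 2 * (1 + A′) ≡ 1 + (1 + 2 * A′)
  double-suc = solve-∀

count-form : ∀ f A′ e → f + 2 ≡ 3 * (1 + A′) + e → f ≡ 3 * A′ + 1 + e
count-form f A′ e eq = +-cancelʳ-≡ 2 f (3 * A′ + 1 + e) (trans eq (regroup A′ e))
  where
  regroup : ∀ A′ e → 3 * (1 + A′) + e ≡ 3 * A′ + 1 + e + 2
  regroup = solve-∀

fork-excess : ℕ → ℕ → ℕ → ℕ → ℕ
fork-excess A′ B′ ea eb = 3 * A′ * B′ + ea * (3 * B′ + 2) + eb * (3 * A′ + 2) + ea * eb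

count-recurrence : ∀ {fa fb} A′ B′ ea eb → fa + 2 ≡ 3 * (1 + A′) + ea → fb + 2 ≡ 3 * (1 + B′) + eb →
  (1 + fa) * (1 + fb) + 2 ≡ 3 * (2 * ((1 + A′) * (1 + B′))) + fork-excess A′ B′ ea eb
count-recurrence {fa} {fb} A′ B′ ea eb ha hb rewrite count-form fa A′ ea ha | count-form fb B′ eb hb = expand A′ B′ ea eb
  where
  expand : ∀ A′ B′ ea eb → (1 + (3 * A′ + 1 + ea)) * (1 + (3 * B′ + 1 + eb)) + 2 ≡
                           3 * (2 * ((1 + A′) * (1 + B′))) +
                           (3 * A′ * B′ + ea * (3 * B′ + 2) + eb * (3 * A′ + 2) + ea * eb)
  expand = solve-∀

nonzero-+suc : ∀ x k → NonZero (x + suc k)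
nonzero-+suc x k rewrite +-suc x k = _

fork-excess≡0⇔ : ∀ A′ B′ ea eb → fork-excess A′ B′ ea eb ≡ 0 ⇔ (ea ≡ 0 × eb ≡ 0 × (A′ ≡ 0 ⊎ B′ ≡ 0))
fork-excess≡0⇔ A′ B′ ea eb = mk⇔ ≡0⇒ ⇒≡0
  where
  ≡0⇒ : fork-excess A′ B′ ea eb ≡ 0 → ea ≡ 0 × eb ≡ 0 × (A′ ≡ 0 ⊎ B′ ≡ 0)
  ≡0⇒ eq =
    let s₁ = m+n≡0⇒m≡0 _ eq
        s₂ = m+n≡0⇒m≡0 _ s₁
    in m*n≡0⇒m≡0 ea (3 * B′ + 2) {{nonzero-+suc (3 * B′) 1}} (m+n≡0⇒n≡0 _ s₂) ,
       m*n≡0⇒m≡0 eb (3 * A′ + 2) {{nonzero-+suc (3 * A′) 1}} (m+n≡0⇒n≡0 _ s₁) ,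
       Sum.map₁ (λ 3A′≡0 → m*n≡0⇒m≡0 A′ 3 (trans (*-comm A′ 3) 3A′≡0)) (m*n≡0⇒m≡0∨n≡0 (3 * A′) (m+n≡0⇒m≡0 _ s₂))
  ⇒≡0 : ea ≡ 0 × eb ≡ 0 × (A′ ≡ 0 ⊎ B′ ≡ 0) → fork-excess A′ B′ ea eb ≡ 0
  ⇒≡0 (refl , refl , inj₁ refl) = refl
  ⇒≡0 (refl , refl , inj₂ refl) = zero-right A′
    where
    zero-right : ∀ A′ → 3 * A′ * 0 + 0 * (3 * 0 + 2) + 0 * (3 * A′ + 2) + 0 * 0 ≡ 0
    zero-right = solve-∀

one-of-two : ∀ {A : Set} {a b x y z : A} → x ≡ a ⊎ x ≡ b → y ≡ a ⊎ y ≡ b → x ≢ y → z ≡ a ⊎ z ≡ b → z ≡ x ⊎ z ≡ y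
one-of-two (inj₁ refl) (inj₁ refl) x≢y _ = ⊥-elim (x≢y refl)
one-of-two (inj₁ refl) (inj₂ refl) _ z∈ab = z∈ab
one-of-two (inj₂ refl) (inj₁ refl) _ z∈ab = Sum.swap z∈ab
one-of-two (inj₂ refl) (inj₂ refl) x≢y _ = ⊥-elim (x≢y refl)

-- Branches of a binary tree

module BinaryTree {n : ℕ} (E : Fin n → Fin n → Set) (bt : IsBinaryTree (full E)) where

  E-sym : ∀ {x y} → E x y → E y x
  E-sym {x} {y} = proj₁ (proj₁ (proj₁ bt)) x y tt tt

  E-irrefl : ∀ {x} → ¬ E x x
  E-irrefl {x} = proj₂ (proj₁ (proj₁ bt)) x tt

  E⇒≢ : ∀ {x y} → E x y → x ≢ y
  E⇒≢ e refl = E-irrefl e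

  connected : Connected (full E)
  connected = proj₁ (proj₂ (proj₁ bt))

  acyclic : ¬ Cycle (full E)
  acyclic = proj₁ (proj₂ (proj₂ (proj₁ bt)))

  degree-1-or-3 : ∀ x d → Deg (full E) x d → d ≢ 1 → d ≡ 3
  degree-1-or-3 x d D d≢1 = proj₂ bt x d tt D d≢1

  open Walks E E-sym public
  open DecMembership (_≟ᶠ_ {n}) using (_∈?_)
  open DecMembership (_≟ˢ_ {n}) using () renaming (_∈?_ to _∈ˢ?_)

  WalkConnected : Subset n → Set
  WalkConnected S = ∀ x y → x ∈ₛ S → y ∈ₛ S → Walk (_∈ₛ S) x y

  -- Subtrees containing r of the branch at r away from p, as connected vertex sets of T avoiding p.
  RootedSubtree : Fin n → Fin n → Subset n → Set
  RootedSubtree p r S = r ∈ₛ S × p ∉ₛ S × WalkConnected S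

  InBranch : Fin n → Fin n → Fin n → Set
  InBranch p r x = Walk (_≢ p) r x

  WalkConnected-hub : ∀ {S h} → (∀ x → x ∈ₛ S → Walk (_∈ₛ S) x h) → WalkConnected S
  WalkConnected-hub to-h x y x∈ y∈ = to-h x x∈ ++ʷ reverseʷ (to-h y y∈)

  RootedSubtree⇒InBranch : ∀ {p r S x} → RootedSubtree p r S → x ∈ₛ S → InBranch p r x
  RootedSubtree⇒InBranch {S = S} (r∈ , p∉ , conn) x∈ =
    mapʷ (λ z z∈ z≡p → p∉ (subst (_∈ₛ S) z≡p z∈)) (conn _ _ r∈ x∈)

  ¬InBranch-parent : ∀ {p r} → ¬ InBranch p r p
  ¬InBranch-parent w = Path-end w refl

  walkSet : ∀ {P x y} → Walk P x y → Subset n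
  walkSet w = setOf (λ z → z ∈? vertices w)

  walkSet-connected : ∀ {P x y} (w : Walk P x y) → WalkConnected (walkSet w)
  walkSet-connected w = WalkConnected-hub (λ u m →
    reverseʷ (mapʷ (λ z → ∈-setOf⁺ (λ z → z ∈? vertices w)) (prefix-to w (∈-setOf⁻ (λ z → z ∈? vertices w) m))))

  InBranch⇒RootedSubtree : ∀ {p r x} → InBranch p r x → Σ (Subset n) (λ S → RootedSubtree p r S × x ∈ₛ S)
  InBranch⇒RootedSubtree w =
    walkSet w ,
    (∈-setOf⁺ (λ z → z ∈? vertices w) (start∈vertices w) ,
     (λ p∈ → All.lookup (vertices-ok w) (∈-setOf⁻ (λ z → z ∈? vertices w) p∈) refl) ,
     walkSet-connected w) ,
    ∈-setOf⁺ (λ z → z ∈? vertices w) (end∈vertices w)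

  InBranch? : ∀ {p r f} → Card (RootedSubtree p r) f → Decidable (InBranch p r)
  InBranch? (L , _ , L⇔ , _) x with any? (x ∈ₛ?_) L
  ... | yes x∈some = let (S , S∈L , x∈S) = find x∈some in yes (RootedSubtree⇒InBranch (to (L⇔ S) S∈L) x∈S)
  ... | no x∉all = no (λ w → let (S , S-sub , x∈S) = InBranch⇒RootedSubtree w in
                              x∉all (lose (from (L⇔ S) S-sub) x∈S))

  ∈-⁅⁆∪⁅⁆⁻ : ∀ {r y z : Fin n} → z ∈ₛ ⁅ r ⁆ ∪ ⁅ y ⁆ → z ≡ r ⊎ z ≡ y
  ∈-⁅⁆∪⁅⁆⁻ {y = y} = Sum.map₂ (x∈⁅y⁆⇒x≡y y) ∘ ∈-⁅⁆∪⁻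

  y∈⁅r⁆∪⁅y⁆ : ∀ {r y : Fin n} → y ∈ₛ ⁅ r ⁆ ∪ ⁅ y ⁆
  y∈⁅r⁆∪⁅y⁆ {y = y} = ∈-⁅⁆∪⁺ (inj₂ (x∈⁅x⁆ y))

  edge-rooted : ∀ {p r y} → E r y → p ≢ r → p ≢ y → RootedSubtree p r (⁅ r ⁆ ∪ ⁅ y ⁆)
  edge-rooted e p≢r p≢y = r∈⁅r⁆∪ , (λ p∈ → [ p≢r , p≢y ]′ (∈-⁅⁆∪⁅⁆⁻ p∈)) ,
    WalkConnected-hub (λ x x∈ → [ (λ { refl → here r∈⁅r⁆∪ }) , (λ { refl → step x∈ (E-sym e) (here r∈⁅r⁆∪) }) ]
                                 (∈-⁅⁆∪⁅⁆⁻ x∈))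

  rooted-edge⇒E : ∀ {p r y} → r ≢ y → RootedSubtree p r (⁅ r ⁆ ∪ ⁅ y ⁆) → E r y
  rooted-edge⇒E r≢y (_ , _ , conn) with conn _ _ r∈⁅r⁆∪ y∈⁅r⁆∪⁅y⁆
  ... | here _ = ⊥-elim (r≢y refl)
  ... | step _ e w with ∈-⁅⁆∪⁅⁆⁻ (Path-start w)
  ...   | inj₁ refl = ⊥-elim (E-irrefl e)
  ...   | inj₂ refl = e

  -- E is not assumed decidable; it is decided through the finite list of rooted subtrees,
  -- as for y ∉ {p, r} the vertex y is adjacent to r iff {r, y} is a rooted subtree.
  adjacent? : ∀ {p r f} → E p r → Card (RootedSubtree p r) f → Decidable (E r)
  adjacent? {p} {r} epr (L , _ , L⇔ , _) y with y ≟ᶠ p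
  ... | yes refl = yes (E-sym epr)
  ... | no y≢p with y ≟ᶠ r
  ...   | yes refl = no E-irrefl
  ...   | no y≢r with (⁅ r ⁆ ∪ ⁅ y ⁆) ∈ˢ? L
  ...     | yes m = yes (rooted-edge⇒E (λ r≡y → y≢r (sym r≡y)) (to (L⇔ _) m))
  ...     | no m = no (λ e → m (from (L⇔ _) (edge-rooted e (λ { refl → E-irrefl epr }) (λ p≡y → y≢p (sym p≡y)))))

  record Fork (p r a b : Fin n) : Set where
    field
      p-r : E p r
      r-a : E r a
      r-b : E r b
      a≢b : a ≢ b
      a≢p : a ≢ p
      b≢p : b ≢ p
      neighbours : ∀ y → E r y → y ≡ p ⊎ y ≡ a ⊎ y ≡ b

  Fork-swap : ∀ {p r a b} → Fork p r a b → Fork p r b a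
  Fork-swap F = record
    { p-r = p-r ; r-a = r-b ; r-b = r-a ; a≢b = λ b≡a → a≢b (sym b≡a) ; a≢p = b≢p ; b≢p = a≢p
    ; neighbours = λ y e → Sum.map₂ Sum.swap (neighbours y e) }
    where open Fork F

  data BranchShape (p r : Fin n) : Set where
    leaf : (∀ y → E r y → y ≡ p) → BranchShape p r
    fork : ∀ a b → Fork p r a b → BranchShape p r

  -- The neighbours of r other than p are listed by L, so deg r = 1 + length L ∈ {1, 3}.
  branch-shape : ∀ {p r} → E p r → Decidable (E r) → BranchShape p r
  branch-shape {p} {r} p-r E? with card-Fin (λ y → E? y ×-dec ¬? (y ≟ᶠ p))
  ... | _ , (L , u , L⇔ , refl) = shape L u L⇔ (degree-1-or-3 r _ degree)
    where
    other-or-p : ∀ {L} → (∀ y → y ∈ L ⇔ (E r y × y ≢ p)) → ∀ y → E r y → y ≡ p ⊎ y ∈ L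
    other-or-p L⇔ y e = Sum.map₂ (λ y≢p → from (L⇔ y) (e , y≢p)) (toSum (y ≟ᶠ p))
    degree : Deg (full E) r (1 + length L)
    degree = card-resp (λ y → [ (λ { refl → tt , E-sym p-r }) , (λ (e , _) → tt , e) ])
                       (λ y (_ , e) → Sum.map₂ (λ y∈L → to (L⇔ y) y∈L) (other-or-p L⇔ y e))
                       (card-⊎ (card-≡ p) (L , u , L⇔ , refl) (λ { _ refl (_ , p≢p) → p≢p refl }))
    shape : ∀ L → Unique L → (∀ y → y ∈ L ⇔ (E r y × y ≢ p)) → (1 + length L ≢ 1 → 1 + length L ≡ 3) →
            BranchShape p r
    shape [] _ []⇔ _ = leaf (λ y e → [ (λ y≡p → y≡p) , (λ ()) ] (other-or-p []⇔ y e))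
    shape (a ∷ []) _ _ deg with deg (λ ())
    ... | ()
    shape (a ∷ b ∷ c ∷ _) _ _ deg with deg (λ ())
    ... | ()
    shape (a ∷ b ∷ []) ((a≢b ∷ []) ∷ _) ab⇔ _ = fork a b record
      { p-r = p-r ; r-a = proj₁ (to (ab⇔ a) (here refl)) ; r-b = proj₁ (to (ab⇔ b) (there (here refl)))
      ; a≢b = a≢b ; a≢p = proj₂ (to (ab⇔ a) (here refl)) ; b≢p = proj₂ (to (ab⇔ b) (there (here refl)))
      ; neighbours = λ y e → Sum.map₂ (λ { (here y≡a) → inj₁ y≡a ; (there (here y≡b)) → inj₂ y≡b })
                                     (other-or-p ab⇔ y e) }

  module Leaf {p r : Fin n} (p-r : E p r) (only-p : ∀ y → E r y → y ≡ p) where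

    leaf-InBranch : ∀ {x} → InBranch p r x → x ≡ r
    leaf-InBranch (here _) = refl
    leaf-InBranch (step _ e w) with only-p _ e
    ... | refl = ⊥-elim (Path-start w refl)

    leaf-order : Card (InBranch p r) 1
    leaf-order = card-resp (λ { x refl → here (E⇒≢ p-r ∘ sym) }) (λ x w → leaf-InBranch w) (card-≡ r)

    leaf-count : Card (RootedSubtree p r) 1
    leaf-count = card-resp (λ { S refl → single-rooted })
                           (λ S sub → ⊆-antisym′ (λ x x∈ → subst (_∈ₛ ⁅ r ⁆) (sym (leaf-InBranch (RootedSubtree⇒InBranch sub x∈))) (x∈⁅x⁆ r))
                                                 (λ x x∈ → subst (_∈ₛ S) (sym (x∈⁅y⁆⇒x≡y r x∈)) (proj₁ sub)))
                           (card-≡ ⁅ r ⁆)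
      where
      single-rooted : RootedSubtree p r ⁅ r ⁆
      single-rooted = x∈⁅x⁆ r , (λ p∈ → E⇒≢ p-r (x∈⁅y⁆⇒x≡y r p∈)) ,
        WalkConnected-hub (λ x x∈ → subst (λ t → Walk _ t r) (sym (x∈⁅y⁆⇒x≡y r x∈)) (here (x∈⁅x⁆ r)))

  Branch : Fin n → Fin n → Graph n
  Branch p r = component (deleteVertex (full E) p) r

  V-Branch⇒InBranch : ∀ {p r x} → V (Branch p r) x → InBranch p r x
  V-Branch⇒InBranch = Path-map (λ _ _ e → e) (λ _ → proj₂)

  InBranch⇒V-Branch : ∀ {p r x} → InBranch p r x → V (Branch p r) x
  InBranch⇒V-Branch = Path-map (λ _ _ e → e) (λ _ q → tt , q)

  subtreeCount⇒card : ∀ {p r k} → SubtreeCount (Branch p r) r k → Card (RootedSubtree p r) k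
  subtreeCount⇒card = card-resp
    (λ S (r∈ , S⊆ , conn , _) → r∈ , (λ p∈ → ¬InBranch-parent (V-Branch⇒InBranch (S⊆ _ p∈))) ,
                                (λ x y x∈ y∈ → Path-cast (λ e → e) (conn x y x∈ y∈)))
    (λ S sub@(r∈ , _ , conn) → r∈ , (λ x x∈ → InBranch⇒V-Branch (RootedSubtree⇒InBranch sub x∈)) ,
                               (λ x y x∈ y∈ → Path-cast (λ e → e) (conn x y x∈ y∈)) , (_ , r∈))

  Order-Branch⇔ : ∀ {p r k} → Order (Branch p r) k ⇔ Card (InBranch p r) k
  Order-Branch⇔ = mk⇔ (card-resp (λ _ → V-Branch⇒InBranch) (λ _ → InBranch⇒V-Branch))
                      (card-resp (λ _ → InBranch⇒V-Branch) (λ _ → V-Branch⇒InBranch))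

  Deg-Branch⇔ : ∀ {p r x d} → Deg (Branch p r) x d ⇔ Card (λ y → InBranch p r y × E x y) d
  Deg-Branch⇔ = mk⇔ (card-resp (λ y (v , e) → V-Branch⇒InBranch v , e) (λ y (w , e) → InBranch⇒V-Branch w , e))
                    (card-resp (λ y (w , e) → InBranch⇒V-Branch w , e) (λ y (v , e) → V-Branch⇒InBranch v , e))

  Branch-isTree : ∀ {p r} → r ≢ p → IsTree (Branch p r)
  Branch-isTree {p} {r} r≢p = ((λ x y _ _ → E-sym) , (λ x _ → E-irrefl)) ,
    (λ x y vx vy → Path-map (λ _ _ e → e) (λ z q → InBranch⇒V-Branch (proj₂ q))
                     (annotate-prefix (λ _ _ z≢p → z≢p) (V-Branch⇒InBranch vx)
                                      (reverseʷ (V-Branch⇒InBranch vx) ++ʷ V-Branch⇒InBranch vy))) ,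
    (λ (x , ys , _ , u , l , lk) → acyclic (x , ys , (λ _ _ → tt) , u , l , lk)) ,
    (r , InBranch⇒V-Branch (here r≢p))

  TrivialBranch : Fin n → Fin n → Set
  TrivialBranch p r = ∀ x → InBranch p r x → x ≡ r

  OnSpine : Fin n → Fin n → Fin n → Set
  OnSpine p r x = V (Branch p r) x × Σ ℕ (λ d → Deg (Branch p r) x d × 2 ≤ d)

  module Child {p r a b : Fin n} (F : Fork p r a b) where
    open Fork F

    r≢p : r ≢ p
    r≢p = E⇒≢ p-r ∘ sym

    a≢r : a ≢ r
    a≢r = E⇒≢ r-a ∘ sym

    b≢r : b ≢ r
    b≢r = E⇒≢ r-b ∘ sym

    p∉branch : ¬ InBranch r a p
    p∉branch = no-detour acyclic r-a (E-sym p-r) a≢p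

    branches-disjoint : ∀ {x} → InBranch r a x → InBranch r b x → ⊥
    branches-disjoint wa wb = no-detour acyclic r-a r-b a≢b (wa ++ʷ reverseʷ wb)

    InBranch-lift : ∀ {x} → InBranch r a x → InBranch p r x
    InBranch-lift w = step r≢p r-a (mapʷ (λ z (_ , wz) z≡p → p∉branch (subst (InBranch r a) z≡p wz))
                                         (annotate-prefix (λ _ _ z≢r → z≢r) (here a≢r) w))

    InBranch-split : ∀ {x} → InBranch p r x → x ≢ r → InBranch r a x ⊎ InBranch r b x
    InBranch-split w x≢r with last-exit _ x≢r w
    ... | z , e , w′ with neighbours z e
    ...   | inj₁ refl = ⊥-elim (proj₁ (Path-start w′) refl)
    ...   | inj₂ (inj₁ refl) = inj₁ (mapʷ (λ _ → proj₂) w′)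
    ...   | inj₂ (inj₂ refl) = inj₂ (mapʷ (λ _ → proj₂) w′)

    walk-to-child : ∀ {S z} → RootedSubtree p r S → z ∈ₛ S → InBranch r a z →
      Walk (λ t → t ∈ₛ S × InBranch r a t) z a
    walk-to-child (r∈ , p∉ , conn) z∈ wz
      with first-entry r (λ z≡r → ¬InBranch-parent (subst (InBranch r a) z≡r wz)) (conn _ r z∈ r∈)
    ... | y , e , w′ with neighbours y (E-sym e)
    ...   | inj₁ refl = ⊥-elim (p∉ (proj₁ (Path-end w′)))
    ...   | inj₂ (inj₂ refl) = ⊥-elim (branches-disjoint (wz ++ʷ mapʷ (λ _ → proj₂) w′) (here b≢r))
    ...   | inj₂ (inj₁ refl) = mapʷ (λ t ((t∈ , _) , wt) → t∈ , wt) (annotate-prefix (λ _ _ t≢r → proj₂ t≢r) wz w′)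

    RootedSubtree-extend : ∀ {A} → RootedSubtree r a A → RootedSubtree p r (⁅ r ⁆ ∪ A)
    RootedSubtree-extend {A} sub@(a∈ , r∉ , conn) = r∈⁅r⁆∪ ,
      (λ p∈ → [ r≢p ∘ sym , p∉branch ∘ RootedSubtree⇒InBranch sub ]′ (∈-⁅⁆∪⁻ p∈)) ,
      WalkConnected-hub (λ x x∈ → [ (λ { refl → here r∈⁅r⁆∪ }) ,
                                    (λ x∈A → mapʷ (λ z → ∈-⁅⁆∪⁺ ∘ inj₂) (conn x a x∈A a∈) ∷ʳʷ (E-sym r-a , r∈⁅r⁆∪)) ]′
                                  (∈-⁅⁆∪⁻ x∈))

    RootedSubtree-restrict : ∀ {A} → r ∉ₛ A → a ∈ₛ A → b ∉ₛ A → RootedSubtree p r (⁅ r ⁆ ∪ A) → RootedSubtree r a A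
    RootedSubtree-restrict {A} r∉ a∈ b∉ (_ , p∉ , conn) = a∈ , r∉ , conn-A
      where
      only-a : ∀ z → z ∈ₛ ⁅ r ⁆ ∪ A → E r z → z ≡ a
      only-a z z∈ e with neighbours z e
      ... | inj₁ refl = ⊥-elim (p∉ z∈)
      ... | inj₂ (inj₁ z≡a) = z≡a
      ... | inj₂ (inj₂ refl) = [ ⊥-elim ∘ b≢r , ⊥-elim ∘ b∉ ]′ (∈-⁅⁆∪⁻ z∈)
      open AvoidPendant r a a≢r only-a
      conn-A : WalkConnected A
      conn-A x y x∈ y∈ =
        mapʷ (λ z (z∈ , z≢r) → [ ⊥-elim ∘ z≢r , (λ z∈A → z∈A) ]′ (∈-⁅⁆∪⁻ z∈))
             (avoid (λ { refl → r∉ x∈ }) (λ { refl → r∉ y∈ }) (conn x y (∈-⁅⁆∪⁺ (inj₂ x∈)) (∈-⁅⁆∪⁺ (inj₂ y∈))))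

    RootedSubtree-child? : ∀ {f} → Card (RootedSubtree p r) f → Decidable (RootedSubtree r a)
    RootedSubtree-child? (L , _ , L⇔ , _) A = map′
      (λ (r∉ , a∈ , b∉ , m) → RootedSubtree-restrict r∉ a∈ b∉ (to (L⇔ _) m))
      (λ sub@(a∈ , r∉ , _) → r∉ , a∈ , (λ b∈ → branches-disjoint (RootedSubtree⇒InBranch sub b∈) (here b≢r)) ,
                             from (L⇔ _) (RootedSubtree-extend sub))
      (¬? (r ∈ₛ? A) ×-dec (a ∈ₛ? A) ×-dec ¬? (b ∈ₛ? A) ×-dec (⁅ r ⁆ ∪ A) ∈ˢ? L)

    neighbour-lift : ∀ {x y} → InBranch r a y × E x y → InBranch p r y × E x y
    neighbour-lift (w , e) = InBranch-lift w , e

    neighbour-lower : ∀ {x y} → InBranch r a x → x ≢ a → InBranch p r y × E x y → InBranch r a y × E x y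
    neighbour-lower {x} {y} wx x≢a (_ , e) with y ≟ᶠ r
    ... | no y≢r = wx ∷ʳʷ (e , y≢r) , e
    ... | yes refl with neighbours x (E-sym e)
    ...   | inj₁ refl = ⊥-elim (p∉branch wx)
    ...   | inj₂ (inj₁ x≡a) = ⊥-elim (x≢a x≡a)
    ...   | inj₂ (inj₂ refl) = ⊥-elim (branches-disjoint wx (here b≢r))

    Deg-child⇔ : ∀ {x d} → InBranch r a x → x ≢ a → Deg (Branch r a) x d ⇔ Deg (Branch p r) x d
    Deg-child⇔ wx x≢a = mk⇔
      (λ D → from Deg-Branch⇔ (card-resp (λ _ → neighbour-lift) (λ _ → neighbour-lower wx x≢a) (to Deg-Branch⇔ D)))
      (λ D → from Deg-Branch⇔ (card-resp (λ _ → neighbour-lower wx x≢a) (λ _ → neighbour-lift) (to Deg-Branch⇔ D)))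

    child-neighbour : ∀ {y} → InBranch p r y × E a y → y ≢ r → InBranch r a y × E a y
    child-neighbour (_ , e) y≢r = here a≢r ∷ʳʷ (e , y≢r) , e

    Deg-child-root⇒ : ∀ {d} → Deg (Branch r a) a d → Deg (Branch p r) a (d + 1)
    Deg-child-root⇒ D = from Deg-Branch⇔ (card-resp
      (λ y → [ neighbour-lift , (λ { refl → here r≢p , E-sym r-a }) ]′)
      (λ y ny → Sum.swap (Sum.map₂ (child-neighbour ny) (toSum (y ≟ᶠ r))))
      (card-⊎ (to Deg-Branch⇔ D) (card-≡ r) (λ { _ (w , _) refl → ¬InBranch-parent w })))

    Deg-child-root⇐ : ∀ {d′} → Deg (Branch p r) a d′ → Σ ℕ (λ d → Deg (Branch r a) a d × d′ ≡ d + 1)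
    Deg-child-root⇐ D with card-∩ (to Deg-Branch⇔ D) (λ y → ¬? (y ≟ᶠ r))
    ... | d , C = d , D-child , card-unique _≟ᶠ_ D (Deg-child-root⇒ D-child)
      where
      D-child : Deg (Branch r a) a d
      D-child = from Deg-Branch⇔ (card-resp (λ y (ny , y≢r) → child-neighbour ny y≢r)
                                            (λ y ny → neighbour-lift ny , (λ { refl → ¬InBranch-parent (proj₁ ny) })) C)

    a∈Branch : V (Branch p r) a
    a∈Branch = InBranch⇒V-Branch (InBranch-lift (here a≢r))

    TrivialBranch⇔Deg1 : TrivialBranch r a ⇔ Deg (Branch p r) a 1
    TrivialBranch⇔Deg1 = mk⇔ trivial⇒deg1 deg1⇒trivial
      where
      trivial⇒deg1 : TrivialBranch r a → Deg (Branch p r) a 1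
      trivial⇒deg1 triv = from Deg-Branch⇔ (card-resp
        (λ { y refl → here r≢p , E-sym r-a })
        (λ y (w , e) → [ (λ y≡r → y≡r) , (λ y≢r → ⊥-elim (E-irrefl (subst (E a) (triv y (here a≢r ∷ʳʷ (e , y≢r))) e))) ]′
                         (toSum (y ≟ᶠ r)))
        (card-≡ r))
      deg1⇒trivial : Deg (Branch p r) a 1 → TrivialBranch r a
      deg1⇒trivial D x (here _) = refl
      deg1⇒trivial D x (step _ e w) = ⊥-elim (Path-start w
        (card-single (to Deg-Branch⇔ D) (InBranch-lift (here a≢r ∷ʳʷ (e , Path-start w)) , e) (here r≢p , E-sym r-a)))

    Deg3⇒OnSpine : Deg (Branch p r) a 3 → OnSpine p r a
    Deg3⇒OnSpine D = a∈Branch , 3 , D , s≤s (s≤s z≤n)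

    Trivial⇒¬OnSpine : TrivialBranch r a → ¬ OnSpine p r a
    Trivial⇒¬OnSpine triv (_ , d , D , 2≤d) with card-unique _≟ᶠ_ D (to TrivialBranch⇔Deg1 triv)
    ... | refl with 2≤d
    ...   | s≤s ()

    Deg-root : Deg (Branch p r) r 2
    Deg-root = from Deg-Branch⇔ (card-resp
      (λ y → [ (λ { refl → InBranch-lift (here a≢r) , r-a }) , (λ { refl → step r≢p r-b (here b≢p) , r-b }) ]′)
      (λ y (w , e) → [ (λ { refl → ⊥-elim (¬InBranch-parent w) }) , (λ y∈ab → y∈ab) ]′ (neighbours y e))
      (card-⊎ (card-≡ a) (card-≡ b) (λ { _ refl refl → a≢b refl })))

  RootedSubtree₀ : Fin n → Fin n → Subset n → Set
  RootedSubtree₀ r c A = A ≡ ∅ ⊎ RootedSubtree r c A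

  card-RootedSubtree₀ : ∀ {r c k} → Card (RootedSubtree r c) k → Card (RootedSubtree₀ r c) (1 + k)
  card-RootedSubtree₀ L = card-⊎ (card-≡ ∅) L (λ { _ refl (c∈ , _) → ∉⊥ c∈ })

  RootedSubtree₀⇒InBranch : ∀ {r c A z} → RootedSubtree₀ r c A → z ∈ₛ A → InBranch r c z
  RootedSubtree₀⇒InBranch (inj₁ refl) z∈ = ⊥-elim (∉⊥ z∈)
  RootedSubtree₀⇒InBranch (inj₂ sub) z∈ = RootedSubtree⇒InBranch sub z∈

  RootedSubtree₀-walk : ∀ {r c A z} → RootedSubtree₀ r c A → z ∈ₛ A → Walk (_∈ₛ A) z c
  RootedSubtree₀-walk (inj₁ refl) z∈ = ⊥-elim (∉⊥ z∈)
  RootedSubtree₀-walk (inj₂ (c∈ , _ , conn)) z∈ = conn _ _ z∈ c∈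

  RootedSubtree₀-∩ : ∀ {r c S} (U? : Decidable (InBranch r c)) → c ≢ r →
    (∀ {z} → z ∈ₛ S → InBranch r c z → Walk (λ t → t ∈ₛ S × InBranch r c t) z c) →
    RootedSubtree₀ r c (S ∩ setOf U?)
  RootedSubtree₀-∩ {c = c} {S} U? c≢r to-c with c ∈ₛ? S
  ... | no c∉ = inj₁ (⊆-antisym′ (λ z z∈ → let (z∈S , wz) = ∈-∩setOf⁻ U? z∈ in ⊥-elim (c∉ (proj₁ (Path-end (to-c z∈S wz)))))
                                 (λ z z∈ → ⊥-elim (∉⊥ z∈)))
  ... | yes c∈ = inj₂ (∈-∩setOf⁺ U? c∈ (here c≢r) ,
                       (λ r∈ → ¬InBranch-parent (proj₂ (∈-∩setOf⁻ U? r∈))) ,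
                       WalkConnected-hub (λ z z∈ → let (z∈S , wz) = ∈-∩setOf⁻ U? z∈ in
                                           mapʷ (λ t (t∈S , wt) → ∈-∩setOf⁺ U? t∈S wt) (to-c z∈S wz)))

  -- A rooted subtree at r is r together with a possibly empty rooted subtree at each child.
  module ForkCount {p r a b : Fin n} (F : Fork p r a b) where
    open Fork F
    module A = Child F
    module B = Child (Fork-swap F)
    open A using (r≢p; a≢r; b≢r)

    child-count : ∀ {f} → Card (RootedSubtree p r) f → Σ ℕ (Card (RootedSubtree r a)) × Σ ℕ (Card (RootedSubtree r b))
    child-count count = card-Vec (A.RootedSubtree-child? count) , card-Vec (B.RootedSubtree-child? count)

    order-fork : ∀ {ka kb} → Card (InBranch r a) ka → Card (InBranch r b) kb → Card (InBranch p r) (1 + (ka + kb))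
    order-fork Ka Kb = card-resp
      (λ x → [ (λ { refl → here r≢p }) , [ A.InBranch-lift , B.InBranch-lift ]′ ]′)
      (λ x w → Sum.map₂ (A.InBranch-split w) (toSum (x ≟ᶠ r)))
      (card-⊎ (card-≡ r) (card-⊎ Ka Kb (λ _ → A.branches-disjoint))
              (λ { _ refl → [ ¬InBranch-parent , ¬InBranch-parent ]′ }))

    glue : Subset n × Subset n → Subset n
    glue (A , B) = ⁅ r ⁆ ∪ (A ∪ B)

    ∈-glue⁻ : ∀ {A B z} → z ∈ₛ glue (A , B) → z ≡ r ⊎ z ∈ₛ A ⊎ z ∈ₛ B
    ∈-glue⁻ {A} {B} z∈ = Sum.map₂ (x∈p∪q⁻ A B) (∈-⁅⁆∪⁻ z∈)

    ∈-glue⁺ : ∀ {A B z} → z ≡ r ⊎ z ∈ₛ A ⊎ z ∈ₛ B → z ∈ₛ glue (A , B)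
    ∈-glue⁺ = ∈-⁅⁆∪⁺ ∘ Sum.map₂ x∈p∪q⁺

    glue-rooted : ∀ {A B} → RootedSubtree₀ r a A → RootedSubtree₀ r b B → RootedSubtree p r (glue (A , B))
    glue-rooted sa sb = ∈-glue⁺ (inj₁ refl) ,
      (λ p∈ → [ r≢p ∘ sym , [ A.p∉branch ∘ RootedSubtree₀⇒InBranch sa , B.p∉branch ∘ RootedSubtree₀⇒InBranch sb ]′ ]′
                (∈-glue⁻ p∈)) ,
      WalkConnected-hub (λ z z∈ → [ (λ { refl → here (∈-glue⁺ (inj₁ refl)) }) ,
                                    [ (λ z∈A → to-r r-a inj₁ (RootedSubtree₀-walk sa z∈A)) ,
                                      (λ z∈B → to-r r-b inj₂ (RootedSubtree₀-walk sb z∈B)) ]′ ]′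
                                  (∈-glue⁻ z∈))
      where
      to-r : ∀ {A B C c z} → E r c → (∀ {t} → t ∈ₛ C → t ∈ₛ A ⊎ t ∈ₛ B) → Walk (_∈ₛ C) z c →
             Walk (_∈ₛ glue (A , B)) z r
      to-r e C⊆ w = mapʷ (λ _ → ∈-glue⁺ ∘ inj₂ ∘ C⊆) w ∷ʳʷ (E-sym e , ∈-glue⁺ (inj₁ refl))

    count-product : ∀ {fa fb} → Card (RootedSubtree r a) fa → Card (RootedSubtree r b) fb →
                    Card (RootedSubtree p r) ((1 + fa) * (1 + fb))
    count-product La Lb =
      card-image (card-× (card-RootedSubtree₀ La) (card-RootedSubtree₀ Lb)) glue split
                 split∘glue (λ _ (sa , sb) → glue-rooted sa sb)
                 (λ S sub → split S , (RootedSubtree₀-∩ Ua? a≢r (A.walk-to-child sub) ,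
                                       RootedSubtree₀-∩ Ub? b≢r (B.walk-to-child sub)) , glue∘split sub)
      where
      Ua? : Decidable (InBranch r a)
      Ua? = InBranch? La
      Ub? : Decidable (InBranch r b)
      Ub? = InBranch? Lb
      split : Subset n → Subset n × Subset n
      split S = S ∩ setOf Ua? , S ∩ setOf Ub?
      split∘glue : ∀ AB → RootedSubtree₀ r a (proj₁ AB) × RootedSubtree₀ r b (proj₂ AB) → split (glue AB) ≡ AB
      split∘glue (A , B) (sa , sb) = cong₂ _,_
        (⊆-antisym′ (λ z z∈ → let (z∈glue , wa) = ∈-∩setOf⁻ Ua? z∈ in
                       [ (λ { refl → ⊥-elim (¬InBranch-parent wa) }) ,
                         [ (λ z∈A → z∈A) , (λ z∈B → ⊥-elim (A.branches-disjoint wa (RootedSubtree₀⇒InBranch sb z∈B))) ]′ ]′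
                       (∈-glue⁻ z∈glue))
                    (λ z z∈A → ∈-∩setOf⁺ Ua? (∈-glue⁺ (inj₂ (inj₁ z∈A))) (RootedSubtree₀⇒InBranch sa z∈A)))
        (⊆-antisym′ (λ z z∈ → let (z∈glue , wb) = ∈-∩setOf⁻ Ub? z∈ in
                       [ (λ { refl → ⊥-elim (¬InBranch-parent wb) }) ,
                         [ (λ z∈A → ⊥-elim (A.branches-disjoint (RootedSubtree₀⇒InBranch sa z∈A) wb)) , (λ z∈B → z∈B) ]′ ]′
                       (∈-glue⁻ z∈glue))
                    (λ z z∈B → ∈-∩setOf⁺ Ub? (∈-glue⁺ (inj₂ (inj₂ z∈B))) (RootedSubtree₀⇒InBranch sb z∈B)))
      glue∘split : ∀ {S} → RootedSubtree p r S → S ≡ glue (split S)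
      glue∘split {S} sub = ⊆-antisym′
        (λ z z∈ → ∈-glue⁺ (Sum.map₂ (λ z≢r → Sum.map (∈-∩setOf⁺ Ua? z∈) (∈-∩setOf⁺ Ub? z∈)
                                                      (A.InBranch-split (RootedSubtree⇒InBranch sub z∈) z≢r))
                                    (toSum (z ≟ᶠ r))))
        (λ z z∈ → [ (λ { refl → proj₁ sub }) , [ proj₁ ∘ ∈-∩setOf⁻ Ua? , proj₁ ∘ ∈-∩setOf⁻ Ub? ]′ ]′ (∈-glue⁻ z∈))

  Caterpillar : Fin n → Fin n → Set
  Caterpillar p r = IsRootedBinaryCaterpillar (Branch p r) r

  DegreesOneOrThree : Fin n → Fin n → Set
  DegreesOneOrThree p r = ∀ x → V (Branch p r) x → x ≢ r → Deg (Branch p r) x 1 ⊎ Deg (Branch p r) x 3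

  PathAdjacency : List (Fin n) → Set
  PathAdjacency L = (i j : Fin (length L)) → E (lookup L i) (lookup L j) →
    (toℕ j ≡ suc (toℕ i)) ⊎ (toℕ i ≡ suc (toℕ j))

  single⇒TrivialBranch : ∀ {p r} → (∀ x → V (Branch p r) x → x ≡ r) → TrivialBranch p r
  single⇒TrivialBranch single x w = single x (InBranch⇒V-Branch w)

  caterpillar-trivial : ∀ {p r} → r ≢ p → TrivialBranch p r → Caterpillar p r
  caterpillar-trivial r≢p triv = Branch-isTree r≢p , InBranch⇒V-Branch (here r≢p) , inj₁ (λ x v → triv x (V-Branch⇒InBranch v))

  lookup-head : ∀ {a : Fin n} {ps} → Unique (a ∷ ps) → (j : Fin (length ps)) → lookup ps j ≢ a
  lookup-head {ps = ps} (a∉ps ∷ _) j eq = All.lookup a∉ps (subst (_∈ ps) eq (∈-lookup j)) refl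

  module ForkCaterpillar {p r a b : Fin n} (F : Fork p r a b) where
    open Fork F
    module A = Child F
    module B = Child (Fork-swap F)
    open A using (r≢p; a≢r; b≢r)

    r-on-spine : OnSpine p r r
    r-on-spine = InBranch⇒V-Branch (here r≢p) , 2 , A.Deg-root , s≤s (s≤s z≤n)

    a-on-spine : Deg (Branch r a) a 2 → OnSpine p r a
    a-on-spine deg2 = A.Deg3⇒OnSpine (A.Deg-child-root⇒ deg2)

    off-spine-b : TrivialBranch r b → ∀ {x} → InBranch r b x → ¬ OnSpine p r x
    off-spine-b triv-b wb spine with triv-b _ wb
    ... | refl = B.Trivial⇒¬OnSpine triv-b spine

    in-branch-a : ∀ {x} → OnSpine p r x → x ≢ r → TrivialBranch r b → InBranch r a x
    in-branch-a spine x≢r triv-b with A.InBranch-split (V-Branch⇒InBranch (proj₁ spine)) x≢r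
    ... | inj₁ wa = wa
    ... | inj₂ wb = ⊥-elim (off-spine-b triv-b wb spine)

    degrees-extend : TrivialBranch r b → Caterpillar r a → DegreesOneOrThree p r
    degrees-extend triv-b (_ , _ , cat-a) x v x≢r with A.InBranch-split (V-Branch⇒InBranch v) x≢r | cat-a
    ... | inj₂ wb | _ = inj₁ (subst (λ t → Deg (Branch p r) t 1) (sym (triv-b x wb)) (to B.TrivialBranch⇔Deg1 triv-b))
    ... | inj₁ wa | inj₁ single = inj₁ (subst (λ t → Deg (Branch p r) t 1) (sym (single⇒TrivialBranch single x wa))
                                              (to A.TrivialBranch⇔Deg1 (single⇒TrivialBranch single)))
    ... | inj₁ wa | inj₂ (deg2 , degrees , _) with x ≟ᶠ a
    ...   | yes refl = inj₂ (A.Deg-child-root⇒ deg2)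
    ...   | no x≢a = Sum.map (to (A.Deg-child⇔ wa x≢a)) (to (A.Deg-child⇔ wa x≢a)) (degrees x (InBranch⇒V-Branch wa) x≢a)

    spine-of-trivial : TrivialBranch r a → TrivialBranch r b → DegAtLeast2InducePathFrom (Branch p r) r
    spine-of-trivial triv-a triv-b = [] , ([] ∷ []) ,
      (λ x → mk⇔ (λ { (here refl) → r-on-spine }) (on-spine⇒r x)) , [-] , (λ { fzero fzero e → ⊥-elim (E-irrefl e) })
      where
      on-spine⇒r : ∀ x → OnSpine p r x → x ∈ r ∷ []
      on-spine⇒r x spine with x ≟ᶠ r
      ... | yes x≡r = here x≡r
      ... | no x≢r with triv-a x (in-branch-a spine x≢r triv-b)
      ...   | refl = ⊥-elim (A.Trivial⇒¬OnSpine triv-a spine)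

    neighbour-on-branch-a : ∀ {y} → InBranch r a y → E r y → y ≡ a
    neighbour-on-branch-a wy e with neighbours _ e
    ... | inj₁ refl = ⊥-elim (A.p∉branch wy)
    ... | inj₂ (inj₁ y≡a) = y≡a
    ... | inj₂ (inj₂ refl) = ⊥-elim (A.branches-disjoint wy (here b≢r))

    spine-extend : TrivialBranch r b → Deg (Branch r a) a 2 → DegAtLeast2InducePathFrom (Branch r a) a →
                   DegAtLeast2InducePathFrom (Branch p r) r
    spine-extend triv-b deg2 (ps , u , mem , linked , adjacency) =
      a ∷ ps , (All.tabulate r∉ ∷ u) , (λ x → mk⇔ (on-spine x) (spine-member x)) , (r-a ∷ linked) , adjacency′
      where
      in-a : ∀ {x} → x ∈ a ∷ ps → InBranch r a x
      in-a m = V-Branch⇒InBranch (proj₁ (to (mem _) m))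
      r∉ : ∀ {x} → x ∈ a ∷ ps → r ≢ x
      r∉ m r≡x = ¬InBranch-parent (subst (InBranch r a) (sym r≡x) (in-a m))
      on-spine : ∀ x → x ∈ r ∷ a ∷ ps → OnSpine p r x
      on-spine x (here refl) = r-on-spine
      on-spine x (there m) with x ≟ᶠ a | to (mem x) m
      ... | yes refl | _ = a-on-spine deg2
      ... | no x≢a | (v , d , D , 2≤d) =
        InBranch⇒V-Branch (A.InBranch-lift (in-a m)) , d , to (A.Deg-child⇔ (in-a m) x≢a) D , 2≤d
      spine-member : ∀ x → OnSpine p r x → x ∈ r ∷ a ∷ ps
      spine-member x spine@(_ , d , D , 2≤d) with x ≟ᶠ r
      ... | yes x≡r = here x≡r
      ... | no x≢r with x ≟ᶠ a
      ...   | yes x≡a = there (here x≡a)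
      ...   | no x≢a = let wa = in-branch-a spine x≢r triv-b in
                       there (from (mem x) (InBranch⇒V-Branch wa , d , from (A.Deg-child⇔ wa x≢a) D , 2≤d))
      at-head : ∀ j → E (lookup (a ∷ ps) j) r → j ≡ fzero
      at-head fzero _ = refl
      at-head (fsuc j) e = ⊥-elim (lookup-head u j (neighbour-on-branch-a (in-a (there (∈-lookup j))) (E-sym e)))
      adjacency′ : PathAdjacency (r ∷ a ∷ ps)
      adjacency′ fzero fzero e = ⊥-elim (E-irrefl e)
      adjacency′ fzero (fsuc j) e = inj₁ (cong (suc ∘ toℕ) (at-head j (E-sym e)))
      adjacency′ (fsuc i) fzero e = inj₂ (cong (suc ∘ toℕ) (at-head i e))
      adjacency′ (fsuc i) (fsuc j) e = Sum.map (cong suc) (cong suc) (adjacency i j e)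

    caterpillar-extend : TrivialBranch r b → Caterpillar r a → Caterpillar p r
    caterpillar-extend triv-b cat-a@(_ , _ , shape-a) =
      Branch-isTree r≢p , InBranch⇒V-Branch (here r≢p) ,
      inj₂ (A.Deg-root , degrees-extend triv-b cat-a ,
            [ (λ single → spine-of-trivial (single⇒TrivialBranch single) triv-b) ,
              (λ (deg2 , _ , spine) → spine-extend triv-b deg2 spine) ]′ shape-a)

    child-degree-2 : DegreesOneOrThree p r → OnSpine p r a → Deg (Branch r a) a 2
    child-degree-2 degrees (_ , _ , D′ , 2≤d) with degrees a A.a∈Branch a≢r
    ... | inj₁ D with card-unique _≟ᶠ_ D′ D
    ...   | refl with 2≤d
    ...     | s≤s ()
    child-degree-2 degrees _ | inj₂ D with A.Deg-child-root⇐ D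
    ... | d , D-child , 3≡d+1 = subst (Deg (Branch r a) a) (sym (suc-injective (trans 3≡d+1 (+-comm d 1)))) D-child

    degrees-restrict : DegreesOneOrThree p r → DegreesOneOrThree r a
    degrees-restrict degrees x v x≢a = Sum.map (from (A.Deg-child⇔ wa x≢a)) (from (A.Deg-child⇔ wa x≢a))
      (degrees x (InBranch⇒V-Branch (A.InBranch-lift wa)) (λ x≡r → ¬InBranch-parent (subst (InBranch r a) x≡r wa)))
      where
      wa : InBranch r a x
      wa = V-Branch⇒InBranch v

    restrict-along-spine : TrivialBranch r b → DegreesOneOrThree p r → ∀ {ps} → Unique (r ∷ a ∷ ps) →
      (∀ x → x ∈ r ∷ a ∷ ps ⇔ OnSpine p r x) → Linked E (a ∷ ps) → PathAdjacency (r ∷ a ∷ ps) → Caterpillar r a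
    restrict-along-spine triv-b degrees {ps} (r∉ ∷ u) mem linked adjacency =
      Branch-isTree a≢r , InBranch⇒V-Branch (here a≢r) ,
      inj₂ (deg2 , degrees-restrict degrees , (ps , u , mem-a , linked , adjacency-a))
      where
      deg2 : Deg (Branch r a) a 2
      deg2 = child-degree-2 degrees (to (mem a) (there (here refl)))
      mem-a : ∀ x → x ∈ a ∷ ps ⇔ OnSpine r a x
      mem-a x = mk⇔ member⇒on-spine on-spine⇒member
        where
        member⇒on-spine : x ∈ a ∷ ps → OnSpine r a x
        member⇒on-spine m with x ≟ᶠ a | to (mem x) (there m)
        ... | yes refl | _ = InBranch⇒V-Branch (here a≢r) , 2 , deg2 , s≤s (s≤s z≤n)
        ... | no x≢a | spine@(_ , d , D , 2≤d) =
          let wa = in-branch-a spine (λ x≡r → All.lookup r∉ m (sym x≡r)) triv-b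
          in InBranch⇒V-Branch wa , d , from (A.Deg-child⇔ wa x≢a) D , 2≤d
        on-spine⇒member : OnSpine r a x → x ∈ a ∷ ps
        on-spine⇒member (v , d , D , 2≤d) with x ≟ᶠ a
        ... | yes x≡a = here x≡a
        ... | no x≢a with from (mem x) (InBranch⇒V-Branch (A.InBranch-lift (V-Branch⇒InBranch v)) , d ,
                                        to (A.Deg-child⇔ (V-Branch⇒InBranch v) x≢a) D , 2≤d)
        ...   | here refl = ⊥-elim (¬InBranch-parent (V-Branch⇒InBranch v))
        ...   | there m = m
      adjacency-a : PathAdjacency (a ∷ ps)
      adjacency-a i j e = Sum.map suc-injective suc-injective (adjacency (fsuc i) (fsuc j) e)

    caterpillar-restrict : TrivialBranch r b → Caterpillar p r → Caterpillar r a
    caterpillar-restrict _ (_ , _ , inj₁ single) = ⊥-elim (a≢r (single a A.a∈Branch))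
    caterpillar-restrict _ (_ , _ , inj₂ (_ , degrees , ([] , _ , mem , _))) = caterpillar-trivial a≢r triv-a
      where
      triv-a : TrivialBranch r a
      triv-a with degrees a A.a∈Branch a≢r
      ... | inj₁ D = from A.TrivialBranch⇔Deg1 D
      ... | inj₂ D with from (mem a) (A.Deg3⇒OnSpine D)
      ...   | here a≡r = ⊥-elim (a≢r a≡r)
    caterpillar-restrict triv-b (_ , _ , inj₂ (_ , degrees , (q ∷ ps , u , mem , r-q ∷ linked , adjacency)))
      with neighbours q r-q
    ... | inj₁ refl = ⊥-elim (¬InBranch-parent (V-Branch⇒InBranch (proj₁ (to (mem q) (there (here refl))))))
    ... | inj₂ (inj₂ refl) = ⊥-elim (B.Trivial⇒¬OnSpine triv-b (to (mem q) (there (here refl))))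
    ... | inj₂ (inj₁ refl) = restrict-along-spine triv-b degrees u mem linked adjacency

    -- Two children of degree 3 would both lie on the spine next to r, i.e. at position 1 of the path.
    trivial-child : Caterpillar p r → TrivialBranch r a ⊎ TrivialBranch r b
    trivial-child (_ , _ , inj₁ single) = ⊥-elim (a≢r (single a A.a∈Branch))
    trivial-child (_ , _ , inj₂ (_ , degrees , (ps , _ , mem , _ , adjacency)))
      with degrees a A.a∈Branch a≢r | degrees b B.a∈Branch b≢r
    ... | inj₁ D | _ = inj₁ (from A.TrivialBranch⇔Deg1 D)
    ... | inj₂ _ | inj₁ D = inj₂ (from B.TrivialBranch⇔Deg1 D)
    ... | inj₂ Da | inj₂ Db =
      ⊥-elim (a≢b (trans (lookup-index a∈) (trans (cong (lookup (r ∷ ps)) (toℕ-injective (trans (at-1 a∈ r-a) (sym (at-1 b∈ r-b)))))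
                                                 (sym (lookup-index b∈)))))
      where
      a∈ : a ∈ r ∷ ps
      a∈ = from (mem a) (A.Deg3⇒OnSpine Da)
      b∈ : b ∈ r ∷ ps
      b∈ = from (mem b) (B.Deg3⇒OnSpine Db)
      at-1 : ∀ {y} (y∈ : y ∈ r ∷ ps) → E r y → toℕ (index y∈) ≡ 1
      at-1 y∈ e with adjacency fzero (index y∈) (subst (E r) (lookup-index y∈) e)
      ... | inj₁ eq = eq
      ... | inj₂ ()

  Caterpillar-fork⇔ : ∀ {p r a b} → Fork p r a b →
    Caterpillar p r ⇔ (Caterpillar r a × Caterpillar r b × (TrivialBranch r a ⊎ TrivialBranch r b))
  Caterpillar-fork⇔ {p} {r} {a} {b} F = mk⇔ split join
    where
    module L = ForkCaterpillar F
    module R = ForkCaterpillar (Fork-swap F)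
    split : Caterpillar p r → Caterpillar r a × Caterpillar r b × (TrivialBranch r a ⊎ TrivialBranch r b)
    split cat with L.trivial-child cat
    ... | inj₁ triv-a = caterpillar-trivial L.A.a≢r triv-a , R.caterpillar-restrict triv-a cat , inj₁ triv-a
    ... | inj₂ triv-b = L.caterpillar-restrict triv-b cat , caterpillar-trivial L.A.b≢r triv-b , inj₂ triv-b
    join : Caterpillar r a × Caterpillar r b × (TrivialBranch r a ⊎ TrivialBranch r b) → Caterpillar p r
    join (_ , cat-b , inj₁ triv-a) = R.caterpillar-extend triv-a cat-b
    join (cat-a , _ , inj₂ triv-b) = L.caterpillar-extend triv-b cat-a

  record BranchCount (p r : Fin n) (f : ℕ) : Set where
    field
      internal : ℕ
      excess : ℕ
      order : Card (InBranch p r) (1 + 2 * internal)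
      count≡ : f + 2 ≡ 3 * 2 ^ internal + excess
      excess≡0⇔caterpillar : excess ≡ 0 ⇔ Caterpillar p r
  open BranchCount public

  internal⇔Order : ∀ {p r f k} (C : BranchCount p r f) → (1 + 2 * internal C ≡ k) ⇔ Order (Branch p r) k
  internal⇔Order C = ⇔-sym (⇔-trans Order-Branch⇔ (card-⇔-≡ _≟ᶠ_ (order C)))

  internal⇔Order+2 : ∀ {p r f K} (C : BranchCount p r f) →
                     (1 + 2 * internal C + 2 ≡ K) ⇔ Σ ℕ (λ k → Order (Branch p r) k × k + 2 ≡ K)
  internal⇔Order+2 C = mk⇔ (λ eq → _ , from Order-Branch⇔ (order C) , eq)
    (λ (k , o , eq) → trans (cong (_+ 2) (card-unique _≟ᶠ_ (order C) (to Order-Branch⇔ o))) eq)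

  TrivialBranch⇔internal≡0 : ∀ {r a α} → a ≢ r → Card (InBranch r a) (1 + 2 * α) → TrivialBranch r a ⇔ α ≡ 0
  TrivialBranch⇔internal≡0 {r} {a} {α} a≢r K =
    mk⇔ (λ triv → 1+2α≡1⇒α≡0 α (card-unique _≟ᶠ_ K (card-resp (λ { x refl → here a≢r }) triv (card-≡ a))))
        (λ { refl x w → card-single K w (here a≢r) })
    where
    1+2α≡1⇒α≡0 : ∀ α → 1 + 2 * α ≡ 1 → α ≡ 0
    1+2α≡1⇒α≡0 zero _ = refl

  leaf-branch-count : ∀ {p r f} → E p r → (∀ y → E r y → y ≡ p) → Card (RootedSubtree p r) f → BranchCount p r f
  leaf-branch-count p-r only-p count = record
    { internal = 0 ; excess = 0 ; order = leaf-order
    ; count≡ = cong (_+ 2) (card-unique _≟ˢ_ count leaf-count)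
    ; excess≡0⇔caterpillar = mk⇔ (λ _ → caterpillar-trivial (E⇒≢ p-r ∘ sym) (λ _ → leaf-InBranch)) (λ _ → refl) }
    where open Leaf p-r only-p

  fork-branch-count : ∀ {p r a b fa fb} → Fork p r a b → BranchCount r a fa → BranchCount r b fb →
                      BranchCount p r ((1 + fa) * (1 + fb))
  fork-branch-count {p} {r} F Ca Cb with 2^-pred (internal Ca) | 2^-pred (internal Cb)
  ... | A′ , 2^α≡ , A′≡0⇔ | B′ , 2^β≡ , B′≡0⇔ = record
    { internal = suc (α + β)
    ; excess = fork-excess A′ B′ (excess Ca) (excess Cb)
    ; order = subst (Card (InBranch p r)) (order-sum α β) (order-fork (order Ca) (order Cb))
    ; count≡ = trans (count-recurrence A′ B′ (excess Ca) (excess Cb) (rebase Ca 2^α≡) (rebase Cb 2^β≡))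
                     (cong (λ t → 3 * (2 * t) + fork-excess A′ B′ (excess Ca) (excess Cb))
                           (sym (trans (^-distribˡ-+-* 2 α β) (cong₂ _*_ 2^α≡ 2^β≡))))
    ; excess≡0⇔caterpillar =
        ⇔-trans (fork-excess≡0⇔ A′ B′ (excess Ca) (excess Cb))
          (⇔-trans (excess≡0⇔caterpillar Ca ×-⇔ excess≡0⇔caterpillar Cb ×-⇔
                    (⇔-trans A′≡0⇔ (⇔-sym (TrivialBranch⇔internal≡0 A.a≢r (order Ca))) ⊎-⇔
                     ⇔-trans B′≡0⇔ (⇔-sym (TrivialBranch⇔internal≡0 A.b≢r (order Cb)))))
                   (⇔-sym (Caterpillar-fork⇔ F))) }
    where
    open ForkCount F
    α β : ℕ
    α = internal Ca
    β = internal Cb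
    rebase : ∀ {c f A′} (C : BranchCount r c f) → 2 ^ internal C ≡ 1 + A′ → f + 2 ≡ 3 * (1 + A′) + excess C
    rebase C 2^≡ = trans (count≡ C) (cong (λ t → 3 * t + excess C) 2^≡)
    order-sum : ∀ α β → 1 + ((1 + 2 * α) + (1 + 2 * β)) ≡ 1 + 2 * suc (α + β)
    order-sum = solve-∀

  branch-count : ∀ {p r f} → E p r → Card (RootedSubtree p r) f → BranchCount p r f
  branch-count {f = f} = <-rec Counted induction-step f
    where
    Counted : ℕ → Set
    Counted f = ∀ {p r} → E p r → Card (RootedSubtree p r) f → BranchCount p r f
    induction-step : ∀ f → (∀ {g} → g < f → Counted g) → Counted f
    induction-step f rec p-r count with branch-shape p-r (adjacent? p-r count)
    ... | leaf only-p = leaf-branch-count p-r only-p count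
    ... | fork a b F with ForkCount.child-count F count
    ...   | (fa , La) , (fb , Lb) =
      subst (BranchCount _ _) (sym f≡) (fork-branch-count F (rec fa<f (Fork.r-a F) La) (rec fb<f (Fork.r-b F) Lb))
      where
      f≡ : f ≡ (1 + fa) * (1 + fb)
      f≡ = card-unique _≟ˢ_ count (ForkCount.count-product F La Lb)
      fa<f : fa < f
      fa<f = ≤-trans (m≤m*n (1 + fa) (1 + fb)) (≤-reflexive (sym f≡))
      fb<f : fb < f
      fb<f = ≤-trans (m≤n*m (1 + fb) (1 + fa)) (≤-reflexive (sym f≡))

  module Pendant {v w : Fin n} (v-w : E v w) (w-leaf : Deg (full E) w 1) where

    w-only-v : ∀ y → E w y → y ≡ v
    w-only-v y e = card-single w-leaf (tt , e) (tt , E-sym v-w)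

    v≢w : v ≢ w
    v≢w = E⇒≢ v-w

    w-unreachable : ∀ {P x} → Path (deleteEdge (full E) v w) P x w → x ≡ w
    w-unreachable (here _) = refl
    w-unreachable (step {x = x} _ (e , not-vw) rest) with w-unreachable rest
    ... | refl = ⊥-elim (not-vw (inj₁ (w-only-v x (E-sym e) , refl)))

    subtreeCount-deleteEdge⇒card : ∀ {f} → SubtreeCount (component (deleteEdge (full E) v w) v) v f → Card (RootedSubtree w v) f
    subtreeCount-deleteEdge⇒card = card-resp
      (λ S (v∈ , S⊆ , conn , _) → v∈ , (λ w∈ → v≢w (w-unreachable (S⊆ w w∈))) ,
                                  (λ x y x∈ y∈ → Path-cast proj₁ (conn x y x∈ y∈)))
      (λ S (v∈ , w∉ , conn) → v∈ , (λ x x∈ → Path-map (keeps-edge w∉) (λ _ _ → tt) (conn v x v∈ x∈)) ,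
                              (λ x y x∈ y∈ → Path-map (keeps-edge w∉) (λ _ x∈ → x∈) (conn x y x∈ y∈)) , (v , v∈))
      where
      keeps-edge : ∀ {S a b} → w ∉ₛ S → a ∈ₛ S → b ∈ₛ S → E a b → E a b × ¬ ((a ≡ v × b ≡ w) ⊎ (a ≡ w × b ≡ v))
      keeps-edge w∉ a∈ b∈ e = e , [ (λ { (_ , refl) → w∉ b∈ }) , (λ { (refl , _) → w∉ a∈ }) ]′

    pendant-fork : ∀ {f v₁ v₂} → Card (RootedSubtree w v) f → E v v₁ → E v v₂ → v₁ ≢ v₂ → v₁ ≢ w → v₂ ≢ w →
                   Fork w v v₁ v₂
    pendant-fork count v-v₁ v-v₂ v₁≢v₂ v₁≢w v₂≢w with branch-shape (E-sym v-w) (adjacent? (E-sym v-w) count)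
    ... | leaf only-w = ⊥-elim (v₁≢w (only-w _ v-v₁))
    ... | fork a b F = record
      { p-r = E-sym v-w ; r-a = v-v₁ ; r-b = v-v₂ ; a≢b = v₁≢v₂ ; a≢p = v₁≢w ; b≢p = v₂≢w
      ; neighbours = λ y e → Sum.map₂ (one-of-two (other v-v₁ v₁≢w) (other v-v₂ v₂≢w) v₁≢v₂) (Fork.neighbours F y e) }
      where
      other : ∀ {x} → E v x → x ≢ w → x ≡ a ⊎ x ≡ b
      other e x≢w = [ ⊥-elim ∘ x≢w , (λ x∈ab → x∈ab) ]′ (Fork.neighbours F _ e)

    order-pendant : ∀ {k} → Card (InBranch w v) k → n ≡ 1 + k
    order-pendant K = card-unique _≟ᶠ_ all-vertices
      (card-resp (λ _ _ → tt) w-or-branch (card-⊎ (card-≡ w) K (λ { _ refl w → Path-end w refl })))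
      where
      open AvoidPendant w v v≢w (λ z _ e → w-only-v z e)
      all-vertices : Card (λ (_ : Fin n) → ⊤) n
      all-vertices = allFin n , allFin⁺ n , (λ x → mk⇔ (λ _ → tt) (λ _ → ∈-allFin x)) , length-tabulate (λ x → x)
      w-or-branch : ∀ x → ⊤ → x ≡ w ⊎ InBranch w v x
      w-or-branch x _ = Sum.map₂ (λ x≢w → mapʷ (λ _ → proj₂) (avoid v≢w x≢w (connected v x tt tt))) (toSum (x ≟ᶠ w))

-- The numerical bound

strict-bound : ∀ {a b} {Q : Set} → a < b → ¬ Q → (a ≤ b) × ((b ≡ a) ⇔ Q)
strict-bound a<b ¬q = <⇒≤ a<b , mk⇔ (λ b≡a → ⊥-elim (<⇒≢ a<b (sym b≡a))) (⊥-elim ∘ ¬q)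

tight-bound : ∀ {a b} x {Q : Set} → b ≡ a + x → (x ≡ 0 ⇔ Q) → (a ≤ b) × ((b ≡ a) ⇔ Q)
tight-bound {a} x refl x≡0⇔ =
  m≤m+n a x ,
  ⇔-trans (mk⇔ (λ a+x≡a → +-cancelˡ-≡ a x 0 (trans a+x≡a (sym (+-identityʳ a)))) (λ { refl → +-identityʳ a })) x≡0⇔

+2-≤⇒∃ : ∀ {f} c → c + 2 ≤ f + 2 → Σ ℕ (λ x → f ≡ c + x)
+2-≤⇒∃ {f} c c+2≤ with m≤n⇒∃[o]m+o≡n c+2≤
... | x , eq = x , +-cancelʳ-≡ 2 f (c + x) (trans (sym eq) (shuffle c x))
  where
  shuffle : ∀ c x → c + 2 + x ≡ c + x + 2
  shuffle = solve-∀

count-form-double : ∀ f M′ e → f + 2 ≡ 3 * (2 * (1 + M′)) + e → f ≡ 6 * M′ + 4 + e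
count-form-double f M′ e eq = +-cancelʳ-≡ 2 f (6 * M′ + 4 + e) (trans eq (regroup M′ e))
  where
  regroup : ∀ M′ e → 3 * (2 * (1 + M′)) + e ≡ 6 * M′ + 4 + e + 2
  regroup = solve-∀

double-<-cancel : ∀ {m β} → m + m < β + β → m < β
double-<-cancel {m} {β} lt with m <? β
... | yes m<β = m<β
... | no m≮β = ⊥-elim (<-irrefl refl (<-≤-trans lt (+-mono-≤ (≮⇒≥ m≮β) (≮⇒≥ m≮β))))

double-cancel : ∀ a b → a + a ≡ b + b → a ≡ b
double-cancel a b eq with <-cmp a b
... | tri≈ _ a≡b _ = a≡b
... | tri< a<b _ _ = ⊥-elim (<⇒≢ (+-mono-< a<b a<b) eq)
... | tri> _ _ b<a = ⊥-elim (<⇒≢ (+-mono-< b<a b<a) (sym eq))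

count-≥-6M : ∀ {f e} m′ γ → suc m′ ≤ γ → f + 2 ≡ 3 * 2 ^ γ + e → 6 * 2 ^ m′ ≤ f + 2
count-≥-6M {f} {e} m′ γ m′<γ f+2≡ = begin
  6 * 2 ^ m′         ≡⟨ regroup (2 ^ m′) ⟩
  3 * 2 ^ suc m′     ≤⟨ *-monoʳ-≤ 3 (^-monoʳ-≤ 2 m′<γ) ⟩
  3 * 2 ^ γ          ≤⟨ m≤m+n _ e ⟩
  3 * 2 ^ γ + e      ≡⟨ sym f+2≡ ⟩
  f + 2              ∎
  where
  open ≤-Reasoning
  regroup : ∀ x → 6 * x ≡ 3 * (2 * x)
  regroup = solve-∀

halve : ∀ {x f₁ f₂} → 2 * x ≤ f₁ + 2 → f₁ ≤ 2 * (1 + f₂) → x ≤ f₂ + 2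
halve {x} {f₁} {f₂} 2x≤ f₁≤ = *-cancelˡ-≤ 2 (≤-trans 2x≤ (≤-trans (+-monoˡ-≤ 2 f₁≤) (≤-reflexive (regroup f₂))))
  where
  regroup : ∀ f₂ → 2 * (1 + f₂) + 2 ≡ 2 * (f₂ + 2)
  regroup = solve-∀

product-strict-even : ∀ {M M′ f₁ f₂} → M ≡ 1 + M′ → 6 * M ≤ f₁ + 2 → 3 * M ≤ f₂ + 2 →
  9 * (M * M) + 1 < (1 + f₁) * (1 + f₂) + 3 * (2 * M)
product-strict-even {M′ = M′} {f₁} {f₂} refl 6M≤ 3M≤
  with +2-≤⇒∃ {f₁} (6 * M′ + 4) (≤-trans (≤-reflexive (six M′)) 6M≤)
     | +2-≤⇒∃ {f₂} (3 * M′ + 1) (≤-trans (≤-reflexive (three M′)) 3M≤)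
  where
  six : ∀ M′ → 6 * M′ + 4 + 2 ≡ 6 * (1 + M′)
  six = solve-∀
  three : ∀ M′ → 3 * M′ + 1 + 2 ≡ 3 * (1 + M′)
  three = solve-∀
... | x , refl | y , refl = ≤-trans (m<m+n _ (s≤s z≤n)) (≤-reflexive (sym (expand M′ x y)))
  where
  expand : ∀ M′ x y → (1 + (6 * M′ + 4 + x)) * (1 + (3 * M′ + 1 + y)) + 3 * (2 * (1 + M′)) ≡
                      9 * ((1 + M′) * (1 + M′)) + 1 + (1 + (9 * M′ * M′ + 15 * M′ + 5 + x * (3 * M′ + 2) + y * (6 * M′ + 5) + x * y))
  expand = solve-∀

product-strict-odd : ∀ {M M′ f₁ f₂} → M ≡ 1 + M′ → 6 * M ≤ f₁ + 2 → 6 * M ≤ f₂ + 2 →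
  9 * (2 * (M * M)) + 1 < (1 + f₁) * (1 + f₂) + 3 * (2 * M) + 3 * M
product-strict-odd {M′ = M′} {f₁} {f₂} refl 6M≤f₁ 6M≤f₂
  with +2-≤⇒∃ {f₁} (6 * M′ + 4) (≤-trans (≤-reflexive (six M′)) 6M≤f₁)
     | +2-≤⇒∃ {f₂} (6 * M′ + 4) (≤-trans (≤-reflexive (six M′)) 6M≤f₂)
  where
  six : ∀ M′ → 6 * M′ + 4 + 2 ≡ 6 * (1 + M′)
  six = solve-∀
... | x , refl | y , refl = ≤-trans (m<m+n _ (s≤s z≤n)) (≤-reflexive (sym (expand M′ x y)))
  where
  expand : ∀ M′ x y → (1 + (6 * M′ + 4 + x)) * (1 + (6 * M′ + 4 + y)) + 3 * (2 * (1 + M′)) + 3 * (1 + M′) ≡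
                      9 * (2 * ((1 + M′) * (1 + M′))) + 1 + (1 + (18 * M′ * M′ + 33 * M′ + 14 + x * (6 * M′ + 5) + y * (6 * M′ + 5) + x * y))
  expand = solve-∀

mixed-excess≡0⇔ : ∀ e₁ e₂ c₁ c₂ → .{{NonZero c₁}} → .{{NonZero c₂}} → (e₁ * c₁ + e₂ * c₂ + e₁ * e₂ ≡ 0) ⇔ (e₁ ≡ 0 × e₂ ≡ 0)
mixed-excess≡0⇔ e₁ e₂ c₁ c₂ = mk⇔
  (λ eq → let s = m+n≡0⇒m≡0 _ eq in m*n≡0⇒m≡0 e₁ c₁ (m+n≡0⇒m≡0 _ s) , m*n≡0⇒m≡0 e₂ c₂ (m+n≡0⇒n≡0 _ s))
  (λ { (refl , refl) → refl })

product-balanced-even : ∀ {M M′ f₁ f₂ e₁ e₂} → M ≡ 1 + M′ → f₁ + 2 ≡ 3 * M + e₁ → f₂ + 2 ≡ 3 * M + e₂ →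
  (1 + f₁) * (1 + f₂) + 3 * (2 * M) ≡ 9 * (M * M) + 1 + (e₁ * (3 * M′ + 2) + e₂ * (3 * M′ + 2) + e₁ * e₂)
product-balanced-even {M′ = M′} {e₁ = e₁} {e₂} refl h₁ h₂
  rewrite count-form _ M′ e₁ h₁ | count-form _ M′ e₂ h₂ = expand M′ e₁ e₂
  where
  expand : ∀ M′ e₁ e₂ → (1 + (3 * M′ + 1 + e₁)) * (1 + (3 * M′ + 1 + e₂)) + 3 * (2 * (1 + M′)) ≡
                        9 * ((1 + M′) * (1 + M′)) + 1 + (e₁ * (3 * M′ + 2) + e₂ * (3 * M′ + 2) + e₁ * e₂)
  expand = solve-∀

product-balanced-odd : ∀ {M M′ f₁ f₂ e₁ e₂} → M ≡ 1 + M′ → f₁ + 2 ≡ 3 * (2 * M) + e₁ → f₂ + 2 ≡ 3 * M + e₂ →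
  (1 + f₁) * (1 + f₂) + 3 * (2 * M) + 3 * M ≡ 9 * (2 * (M * M)) + 1 + (e₁ * (3 * M′ + 2) + e₂ * (6 * M′ + 5) + e₁ * e₂)
product-balanced-odd {M′ = M′} {e₁ = e₁} {e₂} refl h₁ h₂
  rewrite count-form-double _ M′ e₁ h₁ | count-form _ M′ e₂ h₂ = expand M′ e₁ e₂
  where
  expand : ∀ M′ e₁ e₂ → (1 + (6 * M′ + 4 + e₁)) * (1 + (3 * M′ + 1 + e₂)) + 3 * (2 * (1 + M′)) + 3 * (1 + M′) ≡
                        9 * (2 * ((1 + M′) * (1 + M′))) + 1 + (e₁ * (3 * M′ + 2) + e₂ * (6 * M′ + 5) + e₁ * e₂)
  expand = solve-∀

product-bound-even : ∀ m′ {α β f₁ f₂ e₁ e₂} → α + β ≡ m′ + m′ →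
  f₁ + 2 ≡ 3 * 2 ^ α + e₁ → f₂ + 2 ≡ 3 * 2 ^ β + e₂ → f₁ ≤ 2 * (1 + f₂) → f₂ ≤ f₁ →
  (9 * (2 ^ m′ * 2 ^ m′) + 1 ≤ (1 + f₁) * (1 + f₂) + 3 * (2 * 2 ^ m′)) ×
  (((1 + f₁) * (1 + f₂) + 3 * (2 * 2 ^ m′) ≡ 9 * (2 ^ m′ * 2 ^ m′) + 1) ⇔ (e₁ ≡ 0 × e₂ ≡ 0 × α ≡ m′ × β ≡ m′))
product-bound-even m′ {α} {β} {f₁} {f₂} {e₁} {e₂} α+β≡ h₁ h₂ f₁≤ f₂≤ with 2^-pred m′ | <-cmp α β
... | M′ , 2^m′≡ , _ | tri≈ _ refl _ with double-cancel α m′ α+β≡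
...   | refl = tight-bound _ (product-balanced-even 2^m′≡ h₁ h₂)
                 (⇔-trans (mixed-excess≡0⇔ e₁ e₂ (3 * M′ + 2) (3 * M′ + 2) {{nonzero-+suc (3 * M′) 1}} {{nonzero-+suc (3 * M′) 1}})
                          (mk⇔ (λ (e₁≡0 , e₂≡0) → e₁≡0 , e₂≡0 , refl , refl) (λ (e₁≡0 , e₂≡0 , _) → e₁≡0 , e₂≡0)))
product-bound-even m′ {α} {β} {f₁} {f₂} α+β≡ h₁ h₂ f₁≤ f₂≤ | M′ , 2^m′≡ , _ | tri< α<β _ _ =
  strict-bound (product-strict-even 2^m′≡ (≤-trans 6M≤f₂+2 (+-monoˡ-≤ 2 f₂≤)) (≤-trans (*-monoˡ-≤ (2 ^ m′) 3≤6) 6M≤f₂+2))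
               (λ (_ , _ , α≡m′ , β≡m′) → <⇒≢ α<β (trans α≡m′ (sym β≡m′)))
  where
  6M≤f₂+2 : 6 * 2 ^ m′ ≤ f₂ + 2
  6M≤f₂+2 = count-≥-6M m′ β (double-<-cancel (≤-trans (≤-reflexive (cong suc (sym α+β≡))) (+-monoˡ-≤ β α<β))) h₂
  3≤6 : 3 ≤ 6
  3≤6 = s≤s (s≤s (s≤s z≤n))
product-bound-even m′ {α} {β} {f₁} {f₂} α+β≡ h₁ h₂ f₁≤ f₂≤ | M′ , 2^m′≡ , _ | tri> _ _ β<α =
  strict-bound (product-strict-even 2^m′≡ 6M≤f₁+2 (halve (≤-trans (≤-reflexive (regroup (2 ^ m′))) 6M≤f₁+2) f₁≤))
               (λ (_ , _ , α≡m′ , β≡m′) → <⇒≢ β<α (trans β≡m′ (sym α≡m′)))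
  where
  6M≤f₁+2 : 6 * 2 ^ m′ ≤ f₁ + 2
  6M≤f₁+2 = count-≥-6M m′ α (double-<-cancel (≤-trans (≤-reflexive (trans (cong suc (sym α+β≡)) (sym (+-suc α β)))) (+-monoʳ-≤ α β<α))) h₁
  regroup : ∀ x → 2 * (3 * x) ≡ 6 * x
  regroup = solve-∀

product-bound-odd : ∀ m′ {α β f₁ f₂ e₁ e₂} → α + β ≡ suc (m′ + m′) →
  f₁ + 2 ≡ 3 * 2 ^ α + e₁ → f₂ + 2 ≡ 3 * 2 ^ β + e₂ → f₁ ≤ 2 * (1 + f₂) → f₂ ≤ f₁ →
  (9 * (2 * (2 ^ m′ * 2 ^ m′)) + 1 ≤ (1 + f₁) * (1 + f₂) + 3 * (2 * 2 ^ m′) + 3 * 2 ^ m′) ×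
  (((1 + f₁) * (1 + f₂) + 3 * (2 * 2 ^ m′) + 3 * 2 ^ m′ ≡ 9 * (2 * (2 ^ m′ * 2 ^ m′)) + 1) ⇔
   (e₁ ≡ 0 × e₂ ≡ 0 × α ≡ suc m′ × β ≡ m′))
product-bound-odd m′ {α} {β} {f₁} {f₂} {e₁} {e₂} α+β≡ h₁ h₂ f₁≤ f₂≤ with 2^-pred m′ | <-cmp α (suc m′)
... | M′ , 2^m′≡ , _ | tri≈ _ refl _ with +-cancelˡ-≡ m′ β m′ (suc-injective α+β≡)
...   | refl = tight-bound _ (product-balanced-odd 2^m′≡ h₁ h₂)
                 (⇔-trans (mixed-excess≡0⇔ e₁ e₂ (3 * M′ + 2) (6 * M′ + 5) {{nonzero-+suc (3 * M′) 1}} {{nonzero-+suc (6 * M′) 4}})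
                          (mk⇔ (λ (e₁≡0 , e₂≡0) → e₁≡0 , e₂≡0 , refl , refl) (λ (e₁≡0 , e₂≡0 , _) → e₁≡0 , e₂≡0)))
product-bound-odd m′ {α} {β} {f₁} {f₂} α+β≡ h₁ h₂ f₁≤ f₂≤ | M′ , 2^m′≡ , _ | tri< α<1+m′ _ _ =
  strict-bound (product-strict-odd 2^m′≡ (≤-trans 6M≤f₂+2 (+-monoˡ-≤ 2 f₂≤)) 6M≤f₂+2)
               (λ (_ , _ , α≡1+m′ , _) → <⇒≢ α<1+m′ α≡1+m′)
  where
  m′<β : suc m′ ≤ β
  m′<β = +-cancelˡ-≤ m′ (suc m′) β
           (≤-trans (≤-reflexive (trans (+-suc m′ m′) (sym α+β≡))) (+-monoˡ-≤ β (s≤s⁻¹ α<1+m′)))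
  6M≤f₂+2 : 6 * 2 ^ m′ ≤ f₂ + 2
  6M≤f₂+2 = count-≥-6M m′ β m′<β h₂
product-bound-odd m′ {α} {β} {f₁} {f₂} α+β≡ h₁ h₂ f₁≤ f₂≤ | M′ , 2^m′≡ , _ | tri> _ _ 1+m′<α =
  strict-bound (product-strict-odd 2^m′≡ (≤-trans (*-monoʳ-≤ 6 (m≤m+n (2 ^ m′) _)) 12M≤f₁+2)
                                         (halve (≤-trans (≤-reflexive (regroup (2 ^ m′))) 12M≤f₁+2) f₁≤))
               (λ (_ , _ , α≡1+m′ , _) → <⇒≢ 1+m′<α (sym α≡1+m′))
  where
  12M≤f₁+2 : 6 * (2 * 2 ^ m′) ≤ f₁ + 2
  12M≤f₁+2 = count-≥-6M (suc m′) α 1+m′<α h₁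
  regroup : ∀ x → 2 * (6 * x) ≡ 6 * (2 * x)
  regroup = solve-∀

odd-≡⇔ : ∀ {α β k} → k ≡ 1 + 2 * β → (α ≡ β) ⇔ (1 + 2 * α ≡ k)
odd-≡⇔ refl = mk⇔ (cong (λ t → 1 + 2 * t)) (λ eq → *-cancelˡ-≡ _ _ 2 (suc-injective eq))

+2-≡⇔ : ∀ {a b c} → c ≡ b + 2 → (a ≡ b) ⇔ (a + 2 ≡ c)
+2-≡⇔ {a} {b} refl = mk⇔ (cong (_+ 2)) (+-cancelʳ-≡ 2 a b)

bound-4m : ∀ {m α β f f₁ f₂ e₁ e₂} → 4 * m ≡ 2 + ((1 + 2 * α) + (1 + 2 * β)) → f ≡ (1 + f₁) * (1 + f₂) →
  f₁ + 2 ≡ 3 * 2 ^ α + e₁ → f₂ + 2 ≡ 3 * 2 ^ β + e₂ → f₁ ≤ 2 * (1 + f₂) → f₂ ≤ f₁ →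
  (9 * 2 ^ (2 * m ∸ 2) + 1 ≤ f + 3 * 2 ^ m) ×
  ((f + 3 * 2 ^ m ≡ 9 * 2 ^ (2 * m ∸ 2) + 1) ⇔ (e₁ ≡ 0 × e₂ ≡ 0 × 1 + 2 * α ≡ 2 * m ∸ 1 × 1 + 2 * β ≡ 2 * m ∸ 1))
bound-4m {zero} ()
bound-4m {suc m′} {α} {β} {f₁ = f₁} {f₂} {e₁} {e₂} order≡ refl h₁ h₂ f₁≤ f₂≤ =
  subst (λ X → (9 * X + 1 ≤ (1 + f₁) * (1 + f₂) + 3 * 2 ^ suc m′) ×
               (((1 + f₁) * (1 + f₂) + 3 * 2 ^ suc m′ ≡ 9 * X + 1) ⇔
                (e₁ ≡ 0 × e₂ ≡ 0 × 1 + 2 * α ≡ 2 * suc m′ ∸ 1 × 1 + 2 * β ≡ 2 * suc m′ ∸ 1)))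
        (sym (trans (cong (2 ^_) (cong (_∸ 2) (double-suc m′))) (^-distribˡ-+-* 2 m′ m′)))
        (map₂ (λ ≡⇔ → ⇔-trans ≡⇔ (⇔-refl ×-⇔ ⇔-refl ×-⇔ odd-≡⇔ 2m-1≡ ×-⇔ odd-≡⇔ 2m-1≡))
                           (product-bound-even m′ {α} {β} {f₁} {f₂} {e₁} {e₂} α+β≡ h₁ h₂ f₁≤ f₂≤))
  where
  double-suc : ∀ m′ → 2 * suc m′ ≡ 2 + (m′ + m′)
  double-suc = solve-∀
  2m-1≡ : 2 * suc m′ ∸ 1 ≡ 1 + 2 * m′
  2m-1≡ = cong (_∸ 1) (regroup m′)
    where
    regroup : ∀ m′ → 2 * suc m′ ≡ 1 + (1 + 2 * m′)
    regroup = solve-∀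
  α+β≡ : α + β ≡ m′ + m′
  α+β≡ = *-cancelˡ-≡ (α + β) (m′ + m′) 2 (+-cancelˡ-≡ 4 _ _ (trans (sym (order-form α β)) (trans (sym order≡) (size m′))))
    where
    order-form : ∀ α β → 2 + ((1 + 2 * α) + (1 + 2 * β)) ≡ 4 + 2 * (α + β)
    order-form = solve-∀
    size : ∀ m′ → 4 * suc m′ ≡ 4 + 2 * (m′ + m′)
    size = solve-∀

bound-4m+2 : ∀ {m α β f f₁ f₂ e₁ e₂} → 4 * m + 2 ≡ 2 + ((1 + 2 * α) + (1 + 2 * β)) → f ≡ (1 + f₁) * (1 + f₂) →
  f₁ + 2 ≡ 3 * 2 ^ α + e₁ → f₂ + 2 ≡ 3 * 2 ^ β + e₂ → f₁ ≤ 2 * (1 + f₂) → f₂ ≤ f₁ →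
  (9 * 2 ^ (2 * m ∸ 1) + 1 ≤ f + 3 * 2 ^ m + 3 * 2 ^ (m ∸ 1)) ×
  ((f + 3 * 2 ^ m + 3 * 2 ^ (m ∸ 1) ≡ 9 * 2 ^ (2 * m ∸ 1) + 1) ⇔
   (e₁ ≡ 0 × e₂ ≡ 0 × (1 + 2 * β) + 2 ≡ 2 * m + 1 × 1 + 2 * α ≡ 2 * m + 1))
bound-4m+2 {zero} ()
bound-4m+2 {suc m′} {α} {β} {f₁ = f₁} {f₂} {e₁} {e₂} order≡ refl h₁ h₂ f₁≤ f₂≤ =
  subst (λ X → (9 * X + 1 ≤ (1 + f₁) * (1 + f₂) + 3 * 2 ^ suc m′ + 3 * 2 ^ m′) ×
               (((1 + f₁) * (1 + f₂) + 3 * 2 ^ suc m′ + 3 * 2 ^ m′ ≡ 9 * X + 1) ⇔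
                (e₁ ≡ 0 × e₂ ≡ 0 × (1 + 2 * β) + 2 ≡ 2 * suc m′ + 1 × 1 + 2 * α ≡ 2 * suc m′ + 1)))
        (sym (trans (cong (2 ^_) (cong (_∸ 1) (double-suc m′))) (cong (2 *_) (^-distribˡ-+-* 2 m′ m′))))
        (map₂ (λ ≡⇔ → ⇔-trans ≡⇔ (⇔-trans (⇔-refl ×-⇔ ⇔-refl ×-⇔ odd-≡⇔ 2m+1≡ ×-⇔ ⇔-trans (odd-≡⇔ refl) (+2-≡⇔ (regroup m′)))
                                                       (mk⇔ reorder reorder′)))
                           (product-bound-odd m′ {α} {β} {f₁} {f₂} {e₁} {e₂} α+β≡ h₁ h₂ f₁≤ f₂≤))
  where
  double-suc : ∀ m′ → 2 * suc m′ ≡ 1 + suc (m′ + m′)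
  double-suc = solve-∀
  2m+1≡ : 2 * suc m′ + 1 ≡ 1 + 2 * suc m′
  2m+1≡ = +-comm (2 * suc m′) 1
  regroup : ∀ m′ → 2 * suc m′ + 1 ≡ 1 + 2 * m′ + 2
  regroup = solve-∀
  reorder : ∀ {A B C D : Set} → A × B × C × D → A × B × D × C
  reorder (a , b , c , d) = a , b , d , c
  reorder′ : ∀ {A B C D : Set} → A × B × D × C → A × B × C × D
  reorder′ (a , b , d , c) = a , b , c , d
  α+β≡ : α + β ≡ suc (m′ + m′)
  α+β≡ = *-cancelˡ-≡ (α + β) (suc (m′ + m′)) 2 (+-cancelˡ-≡ 4 _ _ (trans (sym (order-form α β)) (trans (sym order≡) (size m′))))
    where
    order-form : ∀ α β → 2 + ((1 + 2 * α) + (1 + 2 * β)) ≡ 4 + 2 * (α + β)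
    order-form = solve-∀
    size : ∀ m′ → 4 * suc m′ + 2 ≡ 4 + 2 * suc (m′ + m′)
    size = solve-∀

lemma4p1 : (n : ℕ) (E : Fin n → Fin n → Set) →
    IsBinaryTree (full E) →
    (v w v₁ v₂ : Fin n) →
    InCore (full E) v →
    E v w → Deg (full E) w 1 →
    E v v₁ → E v v₂ → v₁ ≢ v₂ → v₁ ≢ w → v₂ ≢ w →
    let Tᵥ = component (deleteEdge (full E) v w) v
        T₁ = component (deleteVertex (full E) v) v₁
        T₂ = component (deleteVertex (full E) v) v₂
    in (f f₁ f₂ : ℕ) →
    SubtreeCount Tᵥ v f → SubtreeCount T₁ v₁ f₁ → SubtreeCount T₂ v₂ f₂ →
    2 * (1 + f₂) ≥ f₁ → f₁ ≥ f₂ →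
    (∀ m → n ≡ 4 * m →
       (9 * 2 ^ (2 * m ∸ 2) + 1 ≤ f + 3 * 2 ^ m) ×
       ((f + 3 * 2 ^ m ≡ 9 * 2 ^ (2 * m ∸ 2) + 1) ⇔
        (IsRootedBinaryCaterpillar T₁ v₁ × IsRootedBinaryCaterpillar T₂ v₂ ×
         Order T₁ (2 * m ∸ 1) × Order T₂ (2 * m ∸ 1)))) ×
    (∀ m → n ≡ 4 * m + 2 →
       (9 * 2 ^ (2 * m ∸ 1) + 1 ≤ f + 3 * 2 ^ m + 3 * 2 ^ (m ∸ 1)) ×
       ((f + 3 * 2 ^ m + 3 * 2 ^ (m ∸ 1) ≡ 9 * 2 ^ (2 * m ∸ 1) + 1) ⇔
        (IsRootedBinaryCaterpillar T₁ v₁ × IsRootedBinaryCaterpillar T₂ v₂ ×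
         Σ ℕ (λ k₂ → Order T₂ k₂ × k₂ + 2 ≡ 2 * m + 1) × Order T₁ (2 * m + 1))))
lemma4p1 n E bt v w v₁ v₂ _ v-w w-leaf v-v₁ v-v₂ v₁≢v₂ v₁≢w v₂≢w f f₁ f₂ Fᵥ F₁ F₂ f₁≤ f₂≤ =
  (λ m n≡4m → map₂ (λ tight → ⇔-trans tight (excess≡0⇔caterpillar C₁ ×-⇔ excess≡0⇔caterpillar C₂ ×-⇔
                                               internal⇔Order C₁ ×-⇔ internal⇔Order C₂))
                   (bound-4m {m} {α₁} {α₂} (trans (sym n≡4m) n≡) f≡ (count≡ C₁) (count≡ C₂) f₁≤ f₂≤)) ,
  (λ m n≡4m+2 → map₂ (λ tight → ⇔-trans tight (excess≡0⇔caterpillar C₁ ×-⇔ excess≡0⇔caterpillar C₂ ×-⇔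
                                                 internal⇔Order+2 C₂ ×-⇔ internal⇔Order C₁))
                     (bound-4m+2 {m} {α₁} {α₂} (trans (sym n≡4m+2) n≡) f≡ (count≡ C₁) (count≡ C₂) f₁≤ f₂≤))
  where
  open BinaryTree E bt
  open Pendant v-w w-leaf
  count-v : Card (RootedSubtree w v) f
  count-v = subtreeCount-deleteEdge⇒card Fᵥ
  count₁ : Card (RootedSubtree v v₁) f₁
  count₁ = subtreeCount⇒card F₁
  count₂ : Card (RootedSubtree v v₂) f₂
  count₂ = subtreeCount⇒card F₂
  F : Fork w v v₁ v₂
  F = pendant-fork count-v v-v₁ v-v₂ v₁≢v₂ v₁≢w v₂≢w
  C₁ : BranchCount v v₁ f₁
  C₁ = branch-count v-v₁ count₁
  C₂ : BranchCount v v₂ f₂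
  C₂ = branch-count v-v₂ count₂
  α₁ α₂ : ℕ
  α₁ = internal C₁
  α₂ = internal C₂
  f≡ : f ≡ (1 + f₁) * (1 + f₂)
  f≡ = card-unique _≟ˢ_ count-v (ForkCount.count-product F count₁ count₂)
  n≡ : n ≡ 2 + ((1 + 2 * α₁) + (1 + 2 * α₂))
  n≡ = order-pendant (ForkCount.order-fork F (order C₁) (order C₂))
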